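{- Let $n\geq1$. Define matrices with rows and columns indexed by subsets $S,T\subseteq[n-1]$ and entries in $\mathbb{Z}[q]$: $$A(q)_{ST}=\sum_{\substack{w\in\mathfrak{S}_n\\ \overline{S}\subseteq C(w),\ T\subseteq D(w)}} q^{\mathrm{inv}(w)},\quad B(q)_{ST}=\sum_{\substack{w\in\mathfrak{S}_n\\ \overline{S}\subseteq C(w),\ T= D(w)}} q^{\mathrm{inv}(w)},\quad \Gamma(q)_{ST}=\sum_{\substack{w\in\mathfrak{S}_n\\ C(w)=\overline{S},\ D(w)=T}} q^{\mathrm{inv}(w)}.$$ Then these matrices are invertible and $$A(q)^{ -1}_{ST}=(-1)^{\#S+\#T}A(1/q)_{ST},\qquad B(q)^{ -1}_{ST}=(-1)^{\#S+\#T}\sum_{\substack{w\in\mathfrak{S}_n\\ \overline{S}=C(w),\ T\subseteq D(w)}} q^{ -\mathrm{inv}(w)},\qquad \Gamma(q)^{ -1}_{ST}=(-1)^{\#S+\#T}\Gamma(1/q)_{ST},$$ where $N^{ -1}_{ST}$ denotes the $(S,T)$-entry of $N^{ -1}$.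
   Context: $[n]=\{1,\dots,n\}$, $\mathfrak{S}_n$ is the set of permutations $w=a_1\cdots a_n$ of $[n]$; $\mathrm{inv}(w)=\#\{(i,j): i<j,\ a_i>a_j\}$. For $X\subseteq[n-1]$, $\overline{X}=[n-1]\setminus X$. $D(w)=\{i : a_i>a_{i+1}\}$ and $C(w)=\{i\in[n-1] : a_j<a_k \text{ for all } j\leq i<k\}$. -}

module Defs where

open import Data.Nat using (ℕ; zero; suc; _≤_; _<_; _>_; _≤?_; _<?_)
open import Data.Integer as ℤ using (ℤ; +_; -_; _*_; _+_) renaming (_≟_ to _≟ℤ_)
open import Data.Bool using (Bool; true; false)
open import Data.Bool.Properties using () renaming (_≟_ to _≟B_)
open import Data.Fin using (Fin; toℕ; inject₁) renaming (_≟_ to _≟F_)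
open import Data.Fin.Properties using (all?)
open import Data.Fin.Subset using (Subset; ∁; _⊆_; ∣_∣)
open import Data.Fin.Subset.Properties using (_⊆?_)
open import Data.Vec using (Vec; []; _∷_; lookup; tabulate)
open import Data.Vec.Properties using (≡-dec)
open import Data.List using (List; []; _∷_; map; concatMap; filter; length; allFin; cartesianProduct; _++_; foldr)
open import Data.Product using (_×_; _,_; proj₁; proj₂)
open import Relation.Nullary using (Dec; does; yes; no; ¬_)
open import Relation.Nullary.Decidable using (_→-dec_; _×-dec_)
open import Relation.Binary.PropositionalEquality using (_≡_)

-- Laurent polynomials ℤ[q, q⁻¹]: a finite formal sum of monomials
-- c · q^e, represented as a list of pairs (c , e).

LP : Set
LP = List (ℤ × ℤ)

coeff : ℤ → LP → ℤ
coeff k []             = + 0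
coeff k ((c , e) ∷ p) with does (e ≟ℤ k)
... | true  = c + coeff k p
... | false = coeff k p

infix 4 _≈_
_≈_ : LP → LP → Set
p ≈ r = ∀ k → coeff k p ≡ coeff k r

0L : LP
0L = []

1L : LP
1L = (+ 1 , + 0) ∷ []

qpow : ℤ → LP
qpow e = (+ 1 , e) ∷ []

_+L_ : LP → LP → LP
p +L r = p ++ r

_*L_ : LP → LP → LP
p *L r = map (λ { ((a , e) , (b , f)) → (a * b , e + f) }) (cartesianProduct p r)

_·L_ : ℤ → LP → LP
c ·L p = map (λ { (a , e) → (c * a , e) }) p

ΣL : ∀ {a} {A : Set a} → List A → (A → LP) → LP
ΣL xs f = foldr (λ x acc → f x +L acc) 0L xs

recip : LP → LP
recip = map (λ { (a , e) → (a , - e) })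

sign : ℕ → ℤ
sign zero          = + 1
sign (suc zero)    = - (+ 1)
sign (suc (suc k)) = sign k

allVec : ∀ {a} {A : Set a} → List A → (k : ℕ) → List (Vec A k)
allVec xs zero    = [] ∷ []
allVec xs (suc k) = concatMap (λ x → map (x ∷_) (allVec xs k)) xs

allSubsets : (m : ℕ) → List (Subset m)
allSubsets m = allVec (true ∷ false ∷ []) m

IsPerm : ∀ {n} → Vec (Fin n) n → Set
IsPerm {n} w = ∀ (i j : Fin n) → lookup w i ≡ lookup w j → i ≡ j

isPerm? : ∀ {n} (w : Vec (Fin n) n) → Dec (IsPerm w)
isPerm? w = all? (λ i → all? (λ j → (lookup w i ≟F lookup w j) →-dec (i ≟F _)))

-- 𝔖ₙ in one-line notation
Sym : (n : ℕ) → List (Vec (Fin n) n)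
Sym n = filter isPerm? (allVec (allFin n) n)

-- We take n = suc m, so [n-1] is represented by Fin m:
-- i : Fin m stands for position toℕ i + 1, and positions of the word
-- (Fin (suc m)) are shifted by one likewise (0-based indexing).

Perm : ℕ → Set
Perm m = Vec (Fin (suc m)) (suc m)

inv : ∀ {m} → Perm m → ℕ
inv {m} w = length (filter (λ { (i , j) → (toℕ i <? toℕ j) ×-dec (toℕ (lookup w j) <? toℕ (lookup w i)) })
                           (cartesianProduct (allFin (suc m)) (allFin (suc m))))

IsDescent : ∀ {m} → Perm m → Fin m → Set
IsDescent w i = toℕ (lookup w (inject₁ i)) > toℕ (lookup w (Fin.suc i))

IsCut : ∀ {m} → Perm m → Fin m → Set
IsCut {m} w i = ∀ (j k : Fin (suc m)) → toℕ j ≤ toℕ i → toℕ i < toℕ k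
                  → toℕ (lookup w j) < toℕ (lookup w k)

isCut? : ∀ {m} (w : Perm m) (i : Fin m) → Dec (IsCut w i)
isCut? w i = all? (λ j → all? (λ k → (toℕ j ≤? toℕ i) →-dec ((toℕ i <? toℕ k) →-dec
               (toℕ (lookup w j) <? toℕ (lookup w k)))))

descent? : ∀ {m} (w : Perm m) (i : Fin m) → Dec (IsDescent w i)
descent? w i = toℕ (lookup w (Fin.suc i)) <? toℕ (lookup w (inject₁ i))

D : ∀ {m} → Perm m → Subset m
D w = tabulate (λ i → does (descent? w i))

C : ∀ {m} → Perm m → Subset m
C w = tabulate (λ i → does (isCut? w i))

_≟S_ : ∀ {m} (S T : Subset m) → Dec (S ≡ T)
_≟S_ = ≡-dec _≟B_

Mat : ℕ → Set
Mat m = Subset m → Subset m → LP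

_⊗_ : ∀ {m} → Mat m → Mat m → Mat m
(M ⊗ N) S T = ΣL (allSubsets _) (λ U → M S U *L N U T)

Id : ∀ {m} → Mat m
Id S T with does (S ≟S T)
... | true  = 1L
... | false = 0L

_≈M_ : ∀ {m} → Mat m → Mat m → Set
M ≈M N = ∀ S T → M S T ≈ N S T

IsInverse : ∀ {m} → Mat m → Mat m → Set
IsInverse M N = ((M ⊗ N) ≈M Id) × ((N ⊗ M) ≈M Id)

invSum : ∀ {m} {P : Perm m → Set} → (∀ w → Dec (P w)) → LP
invSum {m} P? = ΣL (filter P? (Sym (suc m))) (λ w → qpow (+ inv w))

A : ∀ {m} → Mat m
A S T = invSum (λ w → (∁ S ⊆? C w) ×-dec (T ⊆? D w))

B : ∀ {m} → Mat m
B S T = invSum (λ w → (∁ S ⊆? C w) ×-dec (T ≟S D w))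

Γ : ∀ {m} → Mat m
Γ S T = invSum (λ w → (C w ≟S ∁ S) ×-dec (D w ≟S T))

B' : ∀ {m} → Mat m
B' S T = invSum (λ w → (∁ S ≟S C w) ×-dec (T ⊆? D w))

signedRecip : ∀ {m} → Mat m → Mat m
signedRecip M S T = sign (∣ S ∣ Data.Nat.+ ∣ T ∣) ·L recip (M S T)

-- A(q)_{ST} sums q^{inv w} over the permutations w of the Young subgroup 𝔖_S (every gap outside S
-- is a cut of w) that have descents on T. Every x ∈ 𝔖_S factors uniquely as x = u v with v ∈ 𝔖_T and
-- T ⊆ D(u); then inv x = inv u − inv v, and x has ascents on a set U ⊆ T exactly when v has descents
-- on U. Hence A(q)_{ST} A(1/q)_{TU} = [U ⊆ T ⊆ S] A↑(q)_{SU}, where A↑ counts the x ∈ 𝔖_S with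
-- ascents on U, and the alternating sum over T in the interval [U, S] vanishes unless U = S, where
-- only the identity is left. Inclusion–exclusion gives B = A μ, B′ = μ A and Γ = μ B for the Möbius
-- matrix μ of the Boolean lattice, whose inverse ζ is its signed reciprocal; this yields the other
-- two inverses.

{-# OPTIONS --safe #-}
module Submission where

open import Level using (Level)
open import Defs
open import Data.Bool using (true; false; if_then_else_)
open import Data.Fin as Fin using (Fin; toℕ; inject₁; inject≤; fromℕ<; punchOut; _≤_; _<_) renaming (_≟_ to _≟F_)
open import Data.Fin.Permutation.Components using (transpose)
open import Data.Fin.Properties
  using (<-cmp; ¬∀⟶∃¬; toℕ-injective; toℕ<n; toℕ-fromℕ<; toℕ-inject≤; toℕ-inject₁; punchOut-injective; injective⇒≤; any?)
open import Data.Fin.Subset using (Subset; _∈_; _∉_; _⊆_; ∁; ⊥; ∣_∣)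
open import Data.Fin.Subset.Properties using (_⊆?_; _∈?_; x∉p⇒x∈∁p; x∈∁p⇒x∉p; p⊆q⇒∁p⊇∁q; ⊥⊆)
open import Data.Integer using (ℤ; +_; -_; _+_; _*_; _-_) renaming (_≟_ to _≟ℤ_)
open import Data.Integer.Properties
  using ( +-assoc; +-comm; +-identityˡ; +-identityʳ; *-assoc; *-comm; *-identityˡ; *-identityʳ; *-zeroˡ; *-zeroʳ
        ; *-distribˡ-+; neg-distrib-+; neg-distribˡ-*; neg-involutive; +-injective; +-inverseˡ
        ; +-commutativeSemigroup; *-commutativeSemigroup )
open import Data.Integer.Tactic.RingSolver using (solve-∀)
open import Algebra.Properties.CommutativeSemigroup +-commutativeSemigroup using (interchange)
open import Algebra.Properties.CommutativeSemigroup *-commutativeSemigroup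
  using (x∙yz≈y∙xz; x∙yz≈y∙zx; xy∙z≈xz∙y; xy∙z≈x∙zy)
open import Data.List using (List; []; _∷_; _++_; map; concatMap; filter; length; cartesianProduct; cartesianProductWith; allFin)
open import Data.List.Membership.Propositional using () renaming (_∈_ to _∈ₗ_)
open import Data.List.Membership.Propositional.Properties
  using (∈-cartesianProduct⁺; ∈-cartesianProduct⁻; ∈-cartesianProductWith⁺; ∈-filter⁺; ∈-filter⁻; ∈-allFin)
open import Data.List.Properties using (map-tabulate)
open import Data.List.Relation.Unary.Any using (here; there)
import Data.List.Relation.Unary.All as All
open import Data.List.Relation.Unary.AllPairs using ([]; _∷_)
open import Data.List.Relation.Unary.Unique.Propositional using (Unique)
import Data.List.Relation.Unary.Unique.Propositional.Properties as Unique
open import Data.Nat as ℕ using (ℕ; zero; suc; s≤s)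
open import Data.Nat.Induction using (<-wellFounded)
open import Data.Nat.ListAction using (sum)
import Data.Nat.Properties as ℕₚ
import Data.Nat.Tactic.RingSolver as ℕ-Solver
open import Data.Product using (_×_; _,_; proj₁; proj₂; ∃)
open import Data.Sum using (_⊎_; inj₁; inj₂)
open import Data.Vec using (Vec; []; _∷_; lookup; tabulate)
open import Data.Vec.Properties using (lookup∘tabulate; tabulate∘lookup; tabulate-cong; []=⇒lookup; lookup⇒[]=; ≡-dec; ∷-injective)
open import Function using (_∘_)
open import Function.Bundles using (_⇔_; mk⇔; Equivalence)
open import Function.Properties.Equivalence using () renaming (sym to ⇔-sym)
open import Induction.WellFounded using (Acc; acc)
open import Relation.Binary.Bundles using (Setoid)
open import Relation.Binary.Definitions using (DecidableEquality; tri<; tri≈; tri>)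
open import Relation.Binary.PropositionalEquality
open import Relation.Nullary using (Dec; yes; no; does; ¬_; contradiction)
open import Relation.Nullary.Decidable using (_×-dec_; _→-dec_; ¬?; does-⇔; dec-true; dec-false)
open import Relation.Unary using (Pred; Decidable)

private
  variable
    a b p : Level
    X Y : Set a
    m n : ℕ

∑ : List X → (X → ℤ) → ℤ
∑ []       f = + 0
∑ (x ∷ xs) f = f x + ∑ xs f

infix 5 ∑
syntax ∑ xs (λ x → e) = ∑[ x ← xs ] e

χ : {P : Set p} → Dec P → ℤ
χ P? = if does P? then + 1 else + 0

χ-⇔ : {P : Set a} {Q : Set b} (P? : Dec P) (Q? : Dec Q) → P ⇔ Q → χ P? ≡ χ Q?
χ-⇔ P? Q? P⇔Q = cong (λ t → if t then + 1 else + 0) (does-⇔ P⇔Q P? Q?)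

χ-yes : {P : Set p} (P? : Dec P) → P → χ P? ≡ + 1
χ-yes P? x rewrite dec-true P? x = refl

χ-no : {P : Set p} (P? : Dec P) → ¬ P → χ P? ≡ + 0
χ-no P? ¬x rewrite dec-false P? ¬x = refl

χ-× : {P : Set a} {Q : Set b} (P? : Dec P) (Q? : Dec Q) → χ (P? ×-dec Q?) ≡ χ P? * χ Q?
χ-× (yes _) (yes _) = refl
χ-× (yes _) (no _)  = refl
χ-× (no _)  (yes _) = refl
χ-× (no _)  (no _)  = refl

χ-≡-sym : {x y : X} (x≟y : Dec (x ≡ y)) (y≟x : Dec (y ≡ x)) → χ x≟y ≡ χ y≟x
χ-≡-sym x≟y y≟x = χ-⇔ x≟y y≟x (mk⇔ sym sym)

∑-cong : (xs : List X) {f g : X → ℤ} → (∀ {x} → x ∈ₗ xs → f x ≡ g x) → ∑ xs f ≡ ∑ xs g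
∑-cong []       f≗g = refl
∑-cong (x ∷ xs) f≗g = cong₂ _+_ (f≗g (here refl)) (∑-cong xs (f≗g ∘ there))

∑-ext : (xs : List X) {f g : X → ℤ} → (∀ x → f x ≡ g x) → ∑ xs f ≡ ∑ xs g
∑-ext xs f≗g = ∑-cong xs (λ {x} _ → f≗g x)

∑-zero : (xs : List X) → ∑[ x ← xs ] + 0 ≡ + 0
∑-zero []       = refl
∑-zero (x ∷ xs) = trans (+-identityˡ _) (∑-zero xs)

∑-++ : (xs ys : List X) (f : X → ℤ) → ∑ (xs ++ ys) f ≡ ∑ xs f + ∑ ys f
∑-++ []       ys f = sym (+-identityˡ _)
∑-++ (x ∷ xs) ys f = trans (cong (_+_ (f x)) (∑-++ xs ys f)) (sym (+-assoc (f x) _ _))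

∑-+ : (xs : List X) (f g : X → ℤ) → ∑[ x ← xs ] (f x + g x) ≡ ∑ xs f + ∑ xs g
∑-+ []       f g = refl
∑-+ (x ∷ xs) f g = trans (cong (_+_ (f x + g x)) (∑-+ xs f g)) (interchange (f x) (g x) _ _)

∑-neg : (xs : List X) (f : X → ℤ) → ∑[ x ← xs ] - f x ≡ - ∑ xs f
∑-neg []       f = refl
∑-neg (x ∷ xs) f = trans (cong (_+_ (- f x)) (∑-neg xs f)) (sym (neg-distrib-+ (f x) _))

∑-*ˡ : (xs : List X) (c : ℤ) (f : X → ℤ) → ∑[ x ← xs ] c * f x ≡ c * ∑ xs f
∑-*ˡ []       c f = sym (*-zeroʳ c)
∑-*ˡ (x ∷ xs) c f = trans (cong (_+_ (c * f x)) (∑-*ˡ xs c f)) (sym (*-distribˡ-+ c (f x) _))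

∑-*ʳ : (xs : List X) (c : ℤ) (f : X → ℤ) → ∑[ x ← xs ] f x * c ≡ ∑ xs f * c
∑-*ʳ xs c f = trans (∑-ext xs (λ x → *-comm (f x) c)) (trans (∑-*ˡ xs c f) (*-comm c _))

∑-map : (g : X → Y) (xs : List X) (f : Y → ℤ) → ∑ (map g xs) f ≡ ∑[ x ← xs ] f (g x)
∑-map g []       f = refl
∑-map g (x ∷ xs) f = cong (_+_ (f (g x))) (∑-map g xs f)

∑-filter : {P : Pred X p} (P? : Decidable P) (xs : List X) (f : X → ℤ) →
           ∑ (filter P? xs) f ≡ ∑[ x ← xs ] χ (P? x) * f x
∑-filter P? []       f = refl
∑-filter P? (x ∷ xs) f with does (P? x)
... | true  = cong₂ _+_ (sym (*-identityˡ (f x))) (∑-filter P? xs f)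
... | false = trans (∑-filter P? xs f) (sym (+-identityˡ _))

∑-comm : (xs : List X) (ys : List Y) (f : X → Y → ℤ) →
         ∑[ x ← xs ] ∑[ y ← ys ] f x y ≡ ∑[ y ← ys ] ∑[ x ← xs ] f x y
∑-comm []       ys f = sym (∑-zero ys)
∑-comm (x ∷ xs) ys f =
  trans (cong (_+_ (∑ ys (f x))) (∑-comm xs ys f)) (sym (∑-+ ys (f x) (λ y → ∑[ x′ ← xs ] f x′ y)))

∑-cartesianProduct : (xs : List X) (ys : List Y) (f : X × Y → ℤ) →
                     ∑ (cartesianProduct xs ys) f ≡ ∑[ x ← xs ] ∑[ y ← ys ] f (x , y)
∑-cartesianProduct []       ys f = refl
∑-cartesianProduct (x ∷ xs) ys f =
  trans (∑-++ (map (x ,_) ys) _ f) (cong₂ _+_ (∑-map (x ,_) ys f) (∑-cartesianProduct xs ys f))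

module _ {P : Pred X p} (P? : Decidable P) where

  ∑-χ-none : (xs : List X) → (∀ {x} → x ∈ₗ xs → ¬ P x) → ∑[ x ← xs ] χ (P? x) ≡ + 0
  ∑-χ-none xs ¬P = trans (∑-cong xs (λ x∈ → χ-no (P? _) (¬P x∈))) (∑-zero xs)

  ∑-χ-unique : {xs : List X} {x₀ : X} → Unique xs → x₀ ∈ₗ xs → P x₀ →
               (∀ {x} → x ∈ₗ xs → P x → x ≡ x₀) → ∑[ x ← xs ] χ (P? x) ≡ + 1
  ∑-χ-unique {x ∷ xs} (x∉xs ∷ _) (here refl) Px₀ only =
    cong₂ _+_ (χ-yes (P? x) Px₀)
              (∑-χ-none xs (λ x′∈ Px′ → All.lookup x∉xs x′∈ (sym (only (there x′∈) Px′))))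
  ∑-χ-unique {x ∷ xs} (x∉xs ∷ u) (there x₀∈) Px₀ only =
    cong₂ _+_ (χ-no (P? x) (λ Px → All.lookup x∉xs x₀∈ (only (here refl) Px)))
              (∑-χ-unique u x₀∈ Px₀ (only ∘ there))

module _ (_≟_ : DecidableEquality X) {xs : List X} (xs! : Unique xs) where

  ∑-δ : {z : X} → z ∈ₗ xs → (f : X → ℤ) → ∑[ x ← xs ] χ (x ≟ z) * f x ≡ f z
  ∑-δ {z} z∈ f = begin
    ∑[ x ← xs ] χ (x ≟ z) * f x   ≡⟨ ∑-ext xs move ⟩
    ∑[ x ← xs ] χ (x ≟ z) * f z   ≡⟨ ∑-*ʳ xs (f z) (λ x → χ (x ≟ z)) ⟩
    (∑[ x ← xs ] χ (x ≟ z)) * f z ≡⟨ cong (_* f z) (∑-χ-unique (_≟ z) xs! z∈ refl (λ _ eq → eq)) ⟩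
    + 1 * f z                      ≡⟨ *-identityˡ (f z) ⟩
    f z                            ∎
    where
    open ≡-Reasoning
    move : ∀ x → χ (x ≟ z) * f x ≡ χ (x ≟ z) * f z
    move x with x ≟ z
    ... | yes refl = refl
    ... | no _     = trans (*-zeroˡ (f x)) (sym (*-zeroˡ (f z)))

∑-reindex : (_≟_ : DecidableEquality Y) {xs : List X} {ys : List Y} → Unique xs → Unique ys →
            (g : X → Y) → (∀ {x} → x ∈ₗ xs → g x ∈ₗ ys) →
            (∀ {y} → y ∈ₗ ys → ∃ λ x → x ∈ₗ xs × g x ≡ y) →
            (∀ {x x′} → x ∈ₗ xs → x′ ∈ₗ xs → g x ≡ g x′ → x ≡ x′) →
            (f : Y → ℤ) → ∑[ x ← xs ] f (g x) ≡ ∑ ys f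
∑-reindex _≟_ {xs} {ys} xs! ys! g into onto inj f = begin
  ∑[ x ← xs ] f (g x)                           ≡⟨ ∑-cong xs (λ x∈ → sym (∑-δ _≟_ ys! (into x∈) f)) ⟩
  ∑[ x ← xs ] ∑[ y ← ys ] χ (y ≟ g x) * f y     ≡⟨ ∑-comm xs ys _ ⟩
  ∑[ y ← ys ] ∑[ x ← xs ] χ (y ≟ g x) * f y     ≡⟨ ∑-ext ys (λ y → ∑-*ʳ xs (f y) (λ x → χ (y ≟ g x))) ⟩
  ∑[ y ← ys ] (∑[ x ← xs ] χ (y ≟ g x)) * f y   ≡⟨ ∑-cong ys (λ y∈ → cong (_* f _) (once y∈)) ⟩
  ∑[ y ← ys ] + 1 * f y                         ≡⟨ ∑-ext ys (λ y → *-identityˡ (f y)) ⟩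
  ∑ ys f                                        ∎
  where
  open ≡-Reasoning
  once : ∀ {y} → y ∈ₗ ys → ∑[ x ← xs ] χ (y ≟ g x) ≡ + 1
  once y∈ with x₀ , x₀∈ , refl ← onto y∈ =
    ∑-χ-unique (λ x → g x₀ ≟ g x) xs! x₀∈ refl (λ x∈ eq → inj x∈ x₀∈ (sym eq))

-- Stated without subtraction, so that it transfers to sums of naturals.
∑-two-point : (_≟_ : DecidableEquality X) {xs : List X} → Unique xs → {p q : X} → p ∈ₗ xs → q ∈ₗ xs → p ≢ q →
              (f g : X → ℤ) → (∀ x → x ≢ p → x ≢ q → f x ≡ g x) →
              ∑ xs f + (g p + g q) ≡ ∑ xs g + (f p + f q)
∑-two-point {X = X} _≟_ {xs} xs! {p} {q} p∈ q∈ p≢q f g agree = begin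
  ∑ xs f + (g p + g q)
    ≡⟨ cong (_+_ (∑ xs f)) (cong₂ _+_ (sym (∑-δ _≟_ xs! p∈ g)) (sym (∑-δ _≟_ xs! q∈ g))) ⟩
  ∑ xs f + (∑ xs (at p g) + ∑ xs (at q g))
    ≡⟨ cong (_+_ (∑ xs f)) (sym (∑-+ xs (at p g) (at q g))) ⟩
  ∑ xs f + (∑[ x ← xs ] (at p g x + at q g x))
    ≡⟨ sym (∑-+ xs f _) ⟩
  ∑[ x ← xs ] (f x + (at p g x + at q g x))
    ≡⟨ ∑-ext xs exchange ⟩
  ∑[ x ← xs ] (g x + (at p f x + at q f x))
    ≡⟨ ∑-+ xs g _ ⟩
  ∑ xs g + (∑[ x ← xs ] (at p f x + at q f x))
    ≡⟨ cong (_+_ (∑ xs g)) (∑-+ xs (at p f) (at q f)) ⟩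
  ∑ xs g + (∑ xs (at p f) + ∑ xs (at q f))
    ≡⟨ cong (_+_ (∑ xs g)) (cong₂ _+_ (∑-δ _≟_ xs! p∈ f) (∑-δ _≟_ xs! q∈ f)) ⟩
  ∑ xs g + (f p + f q) ∎
  where
  open ≡-Reasoning
  at : X → (X → ℤ) → X → ℤ
  at z h x = χ (x ≟ z) * h x
  swap-at-p : ∀ s t → s + (+ 1 * t + + 0 * t) ≡ t + (+ 1 * s + + 0 * s)
  swap-at-p = solve-∀
  swap-at-q : ∀ s t → s + (+ 0 * t + + 1 * t) ≡ t + (+ 0 * s + + 1 * s)
  swap-at-q = solve-∀
  exchange : ∀ x → f x + (at p g x + at q g x) ≡ g x + (at p f x + at q f x)
  exchange x with x ≟ p | x ≟ q
  ... | yes refl | yes refl = contradiction refl p≢q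
  ... | yes refl | no _     = swap-at-p (f x) (g x)
  ... | no _     | yes refl = swap-at-q (f x) (g x)
  ... | no x≢p   | no x≢q   = cong (_+ + 0) (agree x x≢p x≢q)

length-filter : ∀ {P : Pred X p} (P? : Decidable P) (xs : List X) → + length (filter P? xs) ≡ ∑[ x ← xs ] χ (P? x)
length-filter P? []       = refl
length-filter P? (x ∷ xs) with does (P? x)
... | true  = cong (_+_ (+ 1)) (length-filter P? xs)
... | false = trans (length-filter P? xs) (sym (+-identityˡ _))

+-sum : ∀ (xs : List X) (f : X → ℕ) → + sum (map f xs) ≡ ∑[ x ← xs ] + f x
+-sum []       f = refl
+-sum (x ∷ xs) f = cong (_+_ (+ f x)) (+-sum xs f)

∑-only : (_≟_ : DecidableEquality X) {xs : List X} → Unique xs → {z : X} → z ∈ₗ xs → (∀ {x} → x ∈ₗ xs → x ≡ z) →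
         (f : X → ℤ) → ∑ xs f ≡ f z
∑-only _≟_ xs! {z} z∈ only f = trans (sym (∑-reindex _≟_ (All.[] ∷ []) xs! (λ x → x) (λ { (here refl) → z∈ })
                                                     (λ x∈ → z , here refl , sym (only x∈)) (λ { (here refl) (here refl) _ → refl }) f))
                                     (+-identityʳ (f z))

∑-vanishes : (xs : List X) {f : X → ℤ} → (∀ x → f x ≡ + 0) → ∑ xs f ≡ + 0
∑-vanishes xs f≡0 = trans (∑-ext xs f≡0) (∑-zero xs)

∑-no-members : ∀ (xs : List X) (f : X → ℤ) → (∀ {x} → ¬ x ∈ₗ xs) → ∑ xs f ≡ + 0
∑-no-members xs f none = trans (∑-cong xs (λ x∈ → contradiction x∈ none)) (∑-zero xs)

-- Laurent polynomials

term : ℤ → ℤ × ℤ → ℤ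
term k (c , e) = if does (e ≟ℤ k) then c else + 0

coeff-∑ : ∀ k p → coeff k p ≡ ∑ p (term k)
coeff-∑ k []            = refl
coeff-∑ k ((c , e) ∷ p) with does (e ≟ℤ k)
... | true  = cong (_+_ c) (coeff-∑ k p)
... | false = trans (coeff-∑ k p) (sym (+-identityˡ _))

coeff-++ : ∀ k p r → coeff k (p +L r) ≡ coeff k p + coeff k r
coeff-++ k p r = begin
  coeff k (p ++ r)              ≡⟨ coeff-∑ k (p ++ r) ⟩
  ∑ (p ++ r) (term k)           ≡⟨ ∑-++ p r (term k) ⟩
  ∑ p (term k) + ∑ r (term k)   ≡⟨ sym (cong₂ _+_ (coeff-∑ k p) (coeff-∑ k r)) ⟩
  coeff k p + coeff k r         ∎
  where open ≡-Reasoning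

coeff-ΣL : ∀ k (xs : List X) (f : X → LP) → coeff k (ΣL xs f) ≡ ∑[ x ← xs ] coeff k (f x)
coeff-ΣL k []       f = refl
coeff-ΣL k (x ∷ xs) f = trans (coeff-++ k (f x) (ΣL xs f)) (cong (_+_ (coeff k (f x))) (coeff-ΣL k xs f))

coeff-·L : ∀ k c p → coeff k (c ·L p) ≡ c * coeff k p
coeff-·L k c []            = sym (*-zeroʳ c)
coeff-·L k c ((a , e) ∷ p) with does (e ≟ℤ k)
... | true  = trans (cong (_+_ (c * a)) (coeff-·L k c p)) (sym (*-distribˡ-+ c a _))
... | false = coeff-·L k c p

coeff-recip : ∀ k p → coeff k (recip p) ≡ coeff (- k) p
coeff-recip k []            = refl
coeff-recip k ((a , e) ∷ p)
  rewrite does-⇔ (mk⇔ (λ eq → trans (sym (neg-involutive e)) (cong -_ eq))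
                       (λ eq → trans (cong -_ eq) (neg-involutive k)))
                 (- e ≟ℤ k) (e ≟ℤ - k)
  with does (e ≟ℤ - k)
... | true  = cong (_+_ a) (coeff-recip k p)
... | false = coeff-recip k p

coeff-qpow : ∀ k e → coeff k (qpow e) ≡ χ (e ≟ℤ k)
coeff-qpow k e with does (e ≟ℤ k)
... | true  = refl
... | false = refl

+≡⇔≡- : ∀ e f k → (e + f ≡ k) ⇔ (f ≡ k - e)
+≡⇔≡- e f k = mk⇔ (λ eq → trans (sym (cancel e f)) (cong (_- e) eq))
                   (λ eq → trans (cong (_+_ e) eq) (uncancel e k))
  where
  cancel : ∀ e f → e + f - e ≡ f
  cancel = solve-∀
  uncancel : ∀ e k → e + (k - e) ≡ k
  uncancel = solve-∀

term-shift : ∀ k c e d f → term k (c * d , e + f) ≡ c * term (k - e) (d , f)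
term-shift k c e d f rewrite does-⇔ (+≡⇔≡- e f k) (e + f ≟ℤ k) (f ≟ℤ k - e) with does (f ≟ℤ k - e)
... | true  = refl
... | false = sym (*-zeroʳ c)

term-shift′ : ∀ k c e d f → term k (c * d , e + f) ≡ d * term (k - f) (c , e)
term-shift′ k c e d f = trans (cong₂ (λ x y → term k (x , y)) (*-comm c d) (+-comm e f)) (term-shift k d f c e)

coeff-*L-∑∑ : ∀ k p r → coeff k (p *L r) ≡ ∑ p (λ (c , e) → ∑ r (λ (d , f) → term k (c * d , e + f)))
coeff-*L-∑∑ k p r = begin
  coeff k (p *L r)
    ≡⟨ coeff-∑ k (p *L r) ⟩
  ∑ (p *L r) (term k)
    ≡⟨ ∑-map _ (cartesianProduct p r) (term k) ⟩
  ∑ (cartesianProduct p r) (λ ((c , e) , (d , f)) → term k (c * d , e + f))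
    ≡⟨ ∑-cartesianProduct p r _ ⟩
  ∑ p (λ (c , e) → ∑ r (λ (d , f) → term k (c * d , e + f))) ∎
  where open ≡-Reasoning

coeff-*L : ∀ k p r → coeff k (p *L r) ≡ ∑ p (λ (c , e) → c * coeff (k - e) r)
coeff-*L k p r = trans (coeff-*L-∑∑ k p r) (∑-ext p inner)
  where
  open ≡-Reasoning
  inner : ∀ ((c , e) : ℤ × ℤ) → ∑ r (λ (d , f) → term k (c * d , e + f)) ≡ c * coeff (k - e) r
  inner (c , e) = begin
    ∑ r (λ (d , f) → term k (c * d , e + f))   ≡⟨ ∑-ext r (λ (d , f) → term-shift k c e d f) ⟩
    ∑ r (λ y → c * term (k - e) y)             ≡⟨ ∑-*ˡ r c (term (k - e)) ⟩
    c * ∑ r (term (k - e))                     ≡⟨ cong (c *_) (sym (coeff-∑ (k - e) r)) ⟩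
    c * coeff (k - e) r                        ∎

coeff-*L′ : ∀ k p r → coeff k (p *L r) ≡ ∑ r (λ (d , f) → d * coeff (k - f) p)
coeff-*L′ k p r = trans (coeff-*L-∑∑ k p r) (trans (∑-comm p r _) (∑-ext r inner))
  where
  open ≡-Reasoning
  inner : ∀ ((d , f) : ℤ × ℤ) → ∑ p (λ (c , e) → term k (c * d , e + f)) ≡ d * coeff (k - f) p
  inner (d , f) = begin
    ∑ p (λ (c , e) → term k (c * d , e + f))   ≡⟨ ∑-ext p (λ (c , e) → term-shift′ k c e d f) ⟩
    ∑ p (λ x → d * term (k - f) x)             ≡⟨ ∑-*ˡ p d (term (k - f)) ⟩
    d * ∑ p (term (k - f))                     ≡⟨ cong (d *_) (sym (coeff-∑ (k - f) p)) ⟩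
    d * coeff (k - f) p                        ∎

*L-congˡ : ∀ {p p′} r → p ≈ p′ → p *L r ≈ p′ *L r
*L-congˡ {p} {p′} r p≈p′ k = begin
  coeff k (p *L r)                         ≡⟨ coeff-*L′ k p r ⟩
  ∑ r (λ (d , f) → d * coeff (k - f) p)    ≡⟨ ∑-ext r (λ (d , f) → cong (d *_) (p≈p′ (k - f))) ⟩
  ∑ r (λ (d , f) → d * coeff (k - f) p′)   ≡⟨ sym (coeff-*L′ k p′ r) ⟩
  coeff k (p′ *L r)                        ∎
  where open ≡-Reasoning

*L-congʳ : ∀ p {r r′} → r ≈ r′ → p *L r ≈ p *L r′
*L-congʳ p {r} {r′} r≈r′ k = begin
  coeff k (p *L r)                         ≡⟨ coeff-*L k p r ⟩
  ∑ p (λ (c , e) → c * coeff (k - e) r)    ≡⟨ ∑-ext p (λ (c , e) → cong (c *_) (r≈r′ (k - e))) ⟩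
  ∑ p (λ (c , e) → c * coeff (k - e) r′)   ≡⟨ sym (coeff-*L k p r′) ⟩
  coeff k (p *L r′)                        ∎
  where open ≡-Reasoning

ΣL-*L : ∀ (xs : List X) f r → ΣL xs f *L r ≈ ΣL xs (λ x → f x *L r)
ΣL-*L xs f r k = begin
  coeff k (ΣL xs f *L r)
    ≡⟨ coeff-*L′ k (ΣL xs f) r ⟩
  ∑ r (λ (d , e) → d * coeff (k - e) (ΣL xs f))
    ≡⟨ ∑-ext r (λ (d , e) → cong (d *_) (coeff-ΣL (k - e) xs f)) ⟩
  ∑ r (λ (d , e) → d * (∑[ x ← xs ] coeff (k - e) (f x)))
    ≡⟨ ∑-ext r (λ (d , e) → sym (∑-*ˡ xs d _)) ⟩
  ∑ r (λ (d , e) → ∑[ x ← xs ] d * coeff (k - e) (f x))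
    ≡⟨ ∑-comm r xs (λ (d , e) x → d * coeff (k - e) (f x)) ⟩
  ∑[ x ← xs ] ∑ r (λ (d , e) → d * coeff (k - e) (f x))
    ≡⟨ ∑-ext xs (λ x → sym (coeff-*L′ k (f x) r)) ⟩
  ∑[ x ← xs ] coeff k (f x *L r)
    ≡⟨ sym (coeff-ΣL k xs _) ⟩
  coeff k (ΣL xs (λ x → f x *L r)) ∎
  where open ≡-Reasoning

*L-ΣL : ∀ (xs : List X) f r → r *L ΣL xs f ≈ ΣL xs (λ x → r *L f x)
*L-ΣL xs f r k = begin
  coeff k (r *L ΣL xs f)
    ≡⟨ coeff-*L k r (ΣL xs f) ⟩
  ∑ r (λ (d , e) → d * coeff (k - e) (ΣL xs f))
    ≡⟨ ∑-ext r (λ (d , e) → cong (d *_) (coeff-ΣL (k - e) xs f)) ⟩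
  ∑ r (λ (d , e) → d * (∑[ x ← xs ] coeff (k - e) (f x)))
    ≡⟨ ∑-ext r (λ (d , e) → sym (∑-*ˡ xs d _)) ⟩
  ∑ r (λ (d , e) → ∑[ x ← xs ] d * coeff (k - e) (f x))
    ≡⟨ ∑-comm r xs (λ (d , e) x → d * coeff (k - e) (f x)) ⟩
  ∑[ x ← xs ] ∑ r (λ (d , e) → d * coeff (k - e) (f x))
    ≡⟨ ∑-ext xs (λ x → sym (coeff-*L k r (f x))) ⟩
  ∑[ x ← xs ] coeff k (r *L f x)
    ≡⟨ sym (coeff-ΣL k xs _) ⟩
  coeff k (ΣL xs (λ x → r *L f x)) ∎
  where open ≡-Reasoning

*L-assoc : ∀ p q r → (p *L q) *L r ≈ p *L (q *L r)
*L-assoc p q r k = begin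
  coeff k ((p *L q) *L r)
    ≡⟨ coeff-*L′ k (p *L q) r ⟩
  ∑ r (λ (d , f) → d * coeff (k - f) (p *L q))
    ≡⟨ ∑-ext r (λ (d , f) → cong (d *_) (coeff-*L (k - f) p q)) ⟩
  ∑ r (λ (d , f) → d * ∑ p (λ (c , e) → c * coeff (k - f - e) q))
    ≡⟨ ∑-ext r (λ (d , f) → sym (∑-*ˡ p d _)) ⟩
  ∑ r (λ (d , f) → ∑ p (λ (c , e) → d * (c * coeff (k - f - e) q)))
    ≡⟨ ∑-comm r p _ ⟩
  ∑ p (λ (c , e) → ∑ r (λ (d , f) → d * (c * coeff (k - f - e) q)))
    ≡⟨ ∑-ext p (λ (c , e) → ∑-ext r (λ (d , f) → reorder c d e f)) ⟩
  ∑ p (λ (c , e) → ∑ r (λ (d , f) → c * (d * coeff (k - e - f) q)))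
    ≡⟨ ∑-ext p (λ (c , e) → ∑-*ˡ r c _) ⟩
  ∑ p (λ (c , e) → c * ∑ r (λ (d , f) → d * coeff (k - e - f) q))
    ≡⟨ ∑-ext p (λ (c , e) → cong (c *_) (sym (coeff-*L′ (k - e) q r))) ⟩
  ∑ p (λ (c , e) → c * coeff (k - e) (q *L r))
    ≡⟨ sym (coeff-*L k p (q *L r)) ⟩
  coeff k (p *L (q *L r)) ∎
  where
  open ≡-Reasoning
  reorder : ∀ c d e f → d * (c * coeff (k - f - e) q) ≡ c * (d * coeff (k - e - f) q)
  reorder c d e f = trans (cong (λ i → d * (c * coeff i q)) (sub-comm k f e)) (x∙yz≈y∙xz d c _)
    where
    sub-comm : ∀ k f e → k - f - e ≡ k - e - f
    sub-comm = solve-∀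

*L-identityˡ : ∀ p → 1L *L p ≈ p
*L-identityˡ p k = begin
  coeff k (1L *L p)                 ≡⟨ coeff-*L k 1L p ⟩
  + 1 * coeff (k - + 0) p + + 0     ≡⟨ +-identityʳ _ ⟩
  + 1 * coeff (k - + 0) p           ≡⟨ *-identityˡ _ ⟩
  coeff (k - + 0) p                 ≡⟨ cong (λ i → coeff i p) (+-identityʳ k) ⟩
  coeff k p                         ∎
  where open ≡-Reasoning

*L-identityʳ : ∀ p → p *L 1L ≈ p
*L-identityʳ p k = begin
  coeff k (p *L 1L)                 ≡⟨ coeff-*L′ k p 1L ⟩
  + 1 * coeff (k - + 0) p + + 0     ≡⟨ +-identityʳ _ ⟩
  + 1 * coeff (k - + 0) p           ≡⟨ *-identityˡ _ ⟩
  coeff (k - + 0) p                 ≡⟨ cong (λ i → coeff i p) (+-identityʳ k) ⟩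
  coeff k p                         ∎
  where open ≡-Reasoning

·L-*L : ∀ c p r → (c ·L p) *L r ≈ c ·L (p *L r)
·L-*L c p r k = begin
  coeff k ((c ·L p) *L r)
    ≡⟨ coeff-*L′ k (c ·L p) r ⟩
  ∑ r (λ (d , f) → d * coeff (k - f) (c ·L p))
    ≡⟨ ∑-ext r (λ (d , f) → cong (d *_) (coeff-·L (k - f) c p)) ⟩
  ∑ r (λ (d , f) → d * (c * coeff (k - f) p))
    ≡⟨ ∑-ext r (λ (d , f) → x∙yz≈y∙xz d c _) ⟩
  ∑ r (λ (d , f) → c * (d * coeff (k - f) p))
    ≡⟨ ∑-*ˡ r c _ ⟩
  c * ∑ r (λ (d , f) → d * coeff (k - f) p)
    ≡⟨ cong (c *_) (sym (coeff-*L′ k p r)) ⟩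
  c * coeff k (p *L r)
    ≡⟨ sym (coeff-·L k c (p *L r)) ⟩
  coeff k (c ·L (p *L r)) ∎
  where open ≡-Reasoning

*L-·L : ∀ c p r → p *L (c ·L r) ≈ c ·L (p *L r)
*L-·L c p r k = begin
  coeff k (p *L (c ·L r))
    ≡⟨ coeff-*L k p (c ·L r) ⟩
  ∑ p (λ (d , f) → d * coeff (k - f) (c ·L r))
    ≡⟨ ∑-ext p (λ (d , f) → cong (d *_) (coeff-·L (k - f) c r)) ⟩
  ∑ p (λ (d , f) → d * (c * coeff (k - f) r))
    ≡⟨ ∑-ext p (λ (d , f) → x∙yz≈y∙xz d c _) ⟩
  ∑ p (λ (d , f) → c * (d * coeff (k - f) r))
    ≡⟨ ∑-*ˡ p c _ ⟩
  c * ∑ p (λ (d , f) → d * coeff (k - f) r)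
    ≡⟨ cong (c *_) (sym (coeff-*L k p r)) ⟩
  c * coeff k (p *L r)
    ≡⟨ sym (coeff-·L k c (p *L r)) ⟩
  coeff k (c ·L (p *L r)) ∎
  where open ≡-Reasoning

recip-*L : ∀ p r → recip (p *L r) ≈ recip p *L recip r
recip-*L p r k = begin
  coeff k (recip (p *L r))                               ≡⟨ coeff-recip k (p *L r) ⟩
  coeff (- k) (p *L r)                                   ≡⟨ coeff-*L (- k) p r ⟩
  ∑ p (λ (c , e) → c * coeff (- k - e) r)                ≡⟨ ∑-ext p (λ (c , e) → cong (c *_) (shift e)) ⟩
  ∑ p (λ (c , e) → c * coeff (k - - e) (recip r))        ≡⟨ sym (∑-map _ p _) ⟩
  ∑ (recip p) (λ (c , e) → c * coeff (k - e) (recip r))  ≡⟨ sym (coeff-*L k (recip p) (recip r)) ⟩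
  coeff k (recip p *L recip r)                           ∎
  where
  open ≡-Reasoning
  neg-sub : ∀ k e → - k - e ≡ - (k - - e)
  neg-sub = solve-∀
  shift : ∀ e → coeff (- k - e) r ≡ coeff (k - - e) (recip r)
  shift e = trans (cong (λ i → coeff i r) (neg-sub k e)) (sym (coeff-recip (k - - e) r))

coeff-ΣL-qpow : ∀ k (xs : List X) (f : X → ℤ) → coeff k (ΣL xs (λ x → qpow (f x))) ≡ ∑[ x ← xs ] χ (f x ≟ℤ k)
coeff-ΣL-qpow k xs f = trans (coeff-ΣL k xs _) (∑-ext xs (λ x → coeff-qpow k (f x)))

∑-ΣL : ∀ (xs : List X) (h : X → LP) (φ : ℤ × ℤ → ℤ) → ∑ (ΣL xs h) φ ≡ ∑[ x ← xs ] ∑ (h x) φ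
∑-ΣL []       h φ = refl
∑-ΣL (x ∷ xs) h φ = trans (∑-++ (h x) (ΣL xs h) φ) (cong (_+_ (∑ (h x) φ)) (∑-ΣL xs h φ))

coeff-ΣL-qpow-*L : ∀ k (xs : List X) (ys : List Y) (f : X → ℤ) (g : Y → ℤ) →
                   coeff k (ΣL xs (λ x → qpow (f x)) *L ΣL ys (λ y → qpow (g y))) ≡ ∑[ x ← xs ] ∑[ y ← ys ] χ (f x + g y ≟ℤ k)
coeff-ΣL-qpow-*L k xs ys f g = begin
  coeff k (ΣL xs (λ x → qpow (f x)) *L R)
    ≡⟨ coeff-*L k (ΣL xs (λ x → qpow (f x))) R ⟩
  ∑ (ΣL xs (λ x → qpow (f x))) (λ (c , e) → c * coeff (k - e) R)
    ≡⟨ ∑-ΣL xs (λ x → qpow (f x)) _ ⟩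
  ∑[ x ← xs ] (+ 1 * coeff (k - f x) R + + 0)
    ≡⟨ ∑-ext xs (λ x → trans (+-identityʳ _) (*-identityˡ _)) ⟩
  ∑[ x ← xs ] coeff (k - f x) R
    ≡⟨ ∑-ext xs (λ x → coeff-ΣL-qpow (k - f x) ys g) ⟩
  ∑[ x ← xs ] ∑[ y ← ys ] χ (g y ≟ℤ k - f x)
    ≡⟨ ∑-ext xs (λ x → ∑-ext ys (λ y → χ-⇔ (g y ≟ℤ k - f x) (f x + g y ≟ℤ k) (⇔-sym (+≡⇔≡- (f x) (g y) k)))) ⟩
  ∑[ x ← xs ] ∑[ y ← ys ] χ (f x + g y ≟ℤ k) ∎
  where
  open ≡-Reasoning
  R : LP
  R = ΣL ys (λ y → qpow (g y))

recip-ΣL-qpow : ∀ (xs : List X) (f : X → ℤ) → recip (ΣL xs (λ x → qpow (f x))) ≡ ΣL xs (λ x → qpow (- f x))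
recip-ΣL-qpow []       f = refl
recip-ΣL-qpow (x ∷ xs) f = cong ((+ 1 , - f x) ∷_) (recip-ΣL-qpow xs f)

coeff-invSum : ∀ {m} {P : Perm m → Set} (P? : ∀ w → Dec (P w)) k →
               coeff k (invSum P?) ≡ ∑[ w ← Sym (suc m) ] χ (P? w) * χ (+ inv w ≟ℤ k)
coeff-invSum {m} P? k = trans (coeff-ΣL-qpow k (filter P? (Sym (suc m))) (λ w → + inv w)) (∑-filter P? (Sym (suc m)) _)

χ-0≟-k : ∀ k → χ (+ 0 ≟ℤ - k) ≡ χ (+ 0 ≟ℤ k)
χ-0≟-k k = χ-⇔ (+ 0 ≟ℤ - k) (+ 0 ≟ℤ k) (mk⇔ (λ eq → trans (cong -_ eq) (neg-involutive k)) (cong (-_)))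

recip-involutive : ∀ p → recip (recip p) ≈ p
recip-involutive p k = trans (coeff-recip k (recip p)) (trans (coeff-recip (- k) p) (cong (λ i → coeff i p) (neg-involutive k)))

coeff-recip-*L : ∀ k p r → coeff k (recip p *L r) ≡ coeff (- k) (p *L recip r)
coeff-recip-*L k p r = begin
  coeff k (recip p *L r)
    ≡⟨ sym (*L-congʳ (recip p) {recip (recip r)} {r} (recip-involutive r) k) ⟩
  coeff k (recip p *L recip (recip r))
    ≡⟨ sym (recip-*L p (recip r) k) ⟩
  coeff k (recip (p *L recip r))
    ≡⟨ coeff-recip k (p *L recip r) ⟩
  coeff (- k) (p *L recip r) ∎
  where open ≡-Reasoning

concatMap-map : {Z : Set a} (f : X → Y → Z) (xs : List X) (ys : List Y) →
                concatMap (λ x → map (f x) ys) xs ≡ cartesianProductWith f xs ys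
concatMap-map f []       ys = refl
concatMap-map f (x ∷ xs) ys = cong (map (f x) ys ++_) (concatMap-map f xs ys)

allVec-suc : (xs : List X) (k : ℕ) → allVec xs (suc k) ≡ cartesianProductWith _∷_ xs (allVec xs k)
allVec-suc xs k = concatMap-map _∷_ xs (allVec xs k)

∈-allVec : {xs : List X} → (∀ x → x ∈ₗ xs) → ∀ {k} (v : Vec X k) → v ∈ₗ allVec xs k
∈-allVec every []           = here refl
∈-allVec {xs = xs} every {suc k} (x ∷ v) =
  subst ((x ∷ v) ∈ₗ_) (sym (allVec-suc xs k)) (∈-cartesianProductWith⁺ _∷_ (every x) (∈-allVec every v))

allVec-unique : {xs : List X} → Unique xs → ∀ k → Unique (allVec xs k)
allVec-unique xs! zero              = All.[] ∷ []
allVec-unique {xs = xs} xs! (suc k) =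
  subst Unique (sym (allVec-suc xs k)) (Unique.cartesianProductWith⁺ _∷_ ∷-injective xs! (allVec-unique xs! k))

∈-allSubsets : (S : Subset m) → S ∈ₗ allSubsets m
∈-allSubsets = ∈-allVec λ { true → here refl ; false → there (here refl) }

allSubsets-unique : Unique (allSubsets m)
allSubsets-unique {m} = allVec-unique (((λ ()) All.∷ All.[]) ∷ All.[] ∷ []) m

∈-Sym⁺ : ∀ {n} {w : Vec (Fin n) n} → IsPerm w → w ∈ₗ Sym n
∈-Sym⁺ {n} {w} w-perm = ∈-filter⁺ isPerm? (∈-allVec ∈-allFin w) w-perm

∈-Sym⁻ : ∀ {n} {w : Vec (Fin n) n} → w ∈ₗ Sym n → IsPerm w
∈-Sym⁻ {n} w∈ = proj₂ (∈-filter⁻ isPerm? {xs = allVec (allFin n) n} w∈)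

Sym-unique : ∀ n → Unique (Sym n)
Sym-unique n = Unique.filter⁺ isPerm? (allVec-unique (Unique.allFin⁺ n) n)

-- The Boolean lattice

sign-suc : ∀ n → sign (suc n) ≡ - sign n
sign-suc zero          = refl
sign-suc (suc zero)    = refl
sign-suc (suc (suc n)) = sign-suc n

sign-+ : ∀ n o → sign (n ℕ.+ o) ≡ sign n * sign o
sign-+ zero    o = sym (*-identityˡ (sign o))
sign-+ (suc n) o = begin
  sign (suc (n ℕ.+ o))   ≡⟨ sign-suc (n ℕ.+ o) ⟩
  - sign (n ℕ.+ o)       ≡⟨ cong -_ (sign-+ n o) ⟩
  - (sign n * sign o)    ≡⟨ neg-distribˡ-* (sign n) (sign o) ⟩
  - sign n * sign o      ≡⟨ cong (_* sign o) (sym (sign-suc n)) ⟩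
  sign (suc n) * sign o  ∎
  where open ≡-Reasoning

sign-*-sign : ∀ n → sign n * sign n ≡ + 1
sign-*-sign zero          = refl
sign-*-sign (suc zero)    = refl
sign-*-sign (suc (suc n)) = sign-*-sign n

sign-+-+ : ∀ n o r → sign (n ℕ.+ o) * sign (o ℕ.+ r) ≡ sign (n ℕ.+ r)
sign-+-+ n o r = begin
  sign (n ℕ.+ o) * sign (o ℕ.+ r)        ≡⟨ cong₂ _*_ (sign-+ n o) (sign-+ o r) ⟩
  sign n * sign o * (sign o * sign r)    ≡⟨ regroup (sign n) (sign o) (sign r) ⟩
  sign n * (sign o * sign o) * sign r    ≡⟨ cong (λ s → sign n * s * sign r) (sign-*-sign o) ⟩
  sign n * + 1 * sign r                  ≡⟨ cong (_* sign r) (*-identityʳ (sign n)) ⟩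
  sign n * sign r                        ≡⟨ sym (sign-+ n r) ⟩
  sign (n ℕ.+ r)                         ∎
  where
  open ≡-Reasoning
  regroup : ∀ x y z → x * y * (y * z) ≡ x * (y * y) * z
  regroup = solve-∀

∑-allSubsets-suc : ∀ m (f : Subset (suc m) → ℤ) →
                   ∑ (allSubsets (suc m)) f ≡ (∑[ U ← allSubsets m ] f (true ∷ U)) + (∑[ U ← allSubsets m ] f (false ∷ U))
∑-allSubsets-suc m f = begin
  ∑ (allSubsets (suc m)) f                              ≡⟨ ∑-++ (map (true ∷_) (allSubsets m)) _ f ⟩
  ∑ (map (true ∷_) (allSubsets m)) f + ∑ (map (false ∷_) (allSubsets m) ++ []) f
    ≡⟨ cong₂ _+_ (∑-map (true ∷_) (allSubsets m) f) (trans (∑-++ (map (false ∷_) (allSubsets m)) [] f) (+-identityʳ _)) ⟩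
  (∑[ U ← allSubsets m ] f (true ∷ U)) + ∑ (map (false ∷_) (allSubsets m)) f
    ≡⟨ cong (_+_ (∑[ U ← allSubsets m ] f (true ∷ U))) (∑-map (false ∷_) (allSubsets m) f) ⟩
  (∑[ U ← allSubsets m ] f (true ∷ U)) + (∑[ U ← allSubsets m ] f (false ∷ U)) ∎
  where open ≡-Reasoning

alternating-interval : ∀ {m} (X Y : Subset m) →
                       ∑[ U ← allSubsets m ] sign ∣ U ∣ * (χ (X ⊆? U) * χ (U ⊆? Y)) ≡ sign ∣ X ∣ * χ (X ≟S Y)
alternating-interval []      []      = refl
alternating-interval {suc m} (x ∷ X) (y ∷ Y) = trans (∑-allSubsets-suc m _) (by-cases x y)
  where
  open ≡-Reasoning
  I : Subset m → ℤ
  I U = χ (X ⊆? U) * χ (U ⊆? Y)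
  ∑I : ℤ
  ∑I = ∑[ U ← allSubsets m ] sign ∣ U ∣ * I U
  IH : ∑I ≡ sign ∣ X ∣ * χ (X ≟S Y)
  IH = alternating-interval X Y
  odd : ∑[ U ← allSubsets m ] sign (suc ∣ U ∣) * I U ≡ - ∑I
  odd = trans (∑-ext (allSubsets m) (λ U → trans (cong (_* I U) (sign-suc ∣ U ∣)) (sym (neg-distribˡ-* (sign ∣ U ∣) (I U)))))
              (∑-neg (allSubsets m) (λ U → sign ∣ U ∣ * I U))
  vanishes : ∀ s t → s * (t * + 0) ≡ + 0
  vanishes s t = trans (cong (s *_) (*-zeroʳ t)) (*-zeroʳ s)
  by-cases : ∀ x y → (∑[ U ← allSubsets m ] sign ∣ true ∷ U ∣ * (χ (x ∷ X ⊆? true ∷ U) * χ (true ∷ U ⊆? y ∷ Y)))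
                     + (∑[ U ← allSubsets m ] sign ∣ false ∷ U ∣ * (χ (x ∷ X ⊆? false ∷ U) * χ (false ∷ U ⊆? y ∷ Y)))
                     ≡ sign ∣ x ∷ X ∣ * χ ((x ∷ X) ≟S (y ∷ Y))
  by-cases true true = begin
    (∑[ U ← allSubsets m ] sign (suc ∣ U ∣) * I U) + (∑[ U ← allSubsets m ] sign ∣ U ∣ * + 0)
      ≡⟨ cong₂ _+_ odd (∑-vanishes (allSubsets m) (λ U → *-zeroʳ (sign ∣ U ∣))) ⟩
    - ∑I + + 0                         ≡⟨ +-identityʳ (- ∑I) ⟩
    - ∑I                               ≡⟨ cong -_ IH ⟩
    - (sign ∣ X ∣ * χ (X ≟S Y))        ≡⟨ neg-distribˡ-* (sign ∣ X ∣) _ ⟩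
    - sign ∣ X ∣ * χ (X ≟S Y)          ≡⟨ cong (_* χ (X ≟S Y)) (sym (sign-suc ∣ X ∣)) ⟩
    sign (suc ∣ X ∣) * χ (X ≟S Y)      ∎
  by-cases true false =
    trans (cong₂ _+_ (∑-vanishes (allSubsets m) (λ U → vanishes (sign (suc ∣ U ∣)) (χ (X ⊆? U))))
                     (∑-vanishes (allSubsets m) (λ U → *-zeroʳ (sign ∣ U ∣))))
          (sym (*-zeroʳ (sign (suc ∣ X ∣))))
  by-cases false true  = trans (cong (_+ ∑I) odd) (trans (+-inverseˡ ∑I) (sym (*-zeroʳ (sign ∣ X ∣))))
  by-cases false false =
    trans (cong (_+ ∑I) (∑-vanishes (allSubsets m) (λ U → vanishes (sign (suc ∣ U ∣)) (χ (X ⊆? U))))) (trans (+-identityˡ ∑I) IH)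

sign-sign-χ : ∀ {m} (X Y : Subset m) → sign ∣ Y ∣ * (sign ∣ X ∣ * χ (X ≟S Y)) ≡ χ (X ≟S Y)
sign-sign-χ X Y with X ≟S Y
... | yes refl = trans (cong (sign ∣ X ∣ *_) (*-identityʳ _)) (sign-*-sign ∣ X ∣)
... | no _     = trans (cong (sign ∣ Y ∣ *_) (*-zeroʳ (sign ∣ X ∣))) (*-zeroʳ (sign ∣ Y ∣))

∑-sign-interval : ∀ {m} (Z X Y : Subset m) →
                  ∑[ U ← allSubsets m ] sign (∣ Z ∣ ℕ.+ ∣ U ∣) * (χ (X ⊆? U) * χ (U ⊆? Y)) ≡ sign ∣ Z ∣ * (sign ∣ X ∣ * χ (X ≟S Y))
∑-sign-interval {m} Z X Y = begin
  ∑[ U ← allSubsets m ] sign (∣ Z ∣ ℕ.+ ∣ U ∣) * I U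
    ≡⟨ ∑-ext (allSubsets m) (λ U → trans (cong (_* I U) (sign-+ ∣ Z ∣ ∣ U ∣)) (*-assoc (sign ∣ Z ∣) _ _)) ⟩
  ∑[ U ← allSubsets m ] sign ∣ Z ∣ * (sign ∣ U ∣ * I U)
    ≡⟨ ∑-*ˡ (allSubsets m) (sign ∣ Z ∣) _ ⟩
  sign ∣ Z ∣ * (∑[ U ← allSubsets m ] sign ∣ U ∣ * I U)
    ≡⟨ cong (sign ∣ Z ∣ *_) (alternating-interval X Y) ⟩
  sign ∣ Z ∣ * (sign ∣ X ∣ * χ (X ≟S Y)) ∎
  where
  open ≡-Reasoning
  I : Subset m → ℤ
  I U = χ (X ⊆? U) * χ (U ⊆? Y)

alternating-intervalˡ : ∀ {m} (X Y : Subset m) →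
                        ∑[ U ← allSubsets m ] sign (∣ U ∣ ℕ.+ ∣ X ∣) * (χ (X ⊆? U) * χ (U ⊆? Y)) ≡ χ (X ≟S Y)
alternating-intervalˡ {m} X Y = begin
  ∑[ U ← allSubsets m ] sign (∣ U ∣ ℕ.+ ∣ X ∣) * (χ (X ⊆? U) * χ (U ⊆? Y))
    ≡⟨ ∑-ext (allSubsets m) (λ U → cong (λ n → sign n * (χ (X ⊆? U) * χ (U ⊆? Y))) (ℕₚ.+-comm ∣ U ∣ ∣ X ∣)) ⟩
  ∑[ U ← allSubsets m ] sign (∣ X ∣ ℕ.+ ∣ U ∣) * (χ (X ⊆? U) * χ (U ⊆? Y))
    ≡⟨ ∑-sign-interval X X Y ⟩
  sign ∣ X ∣ * (sign ∣ X ∣ * χ (X ≟S Y))    ≡⟨ sym (*-assoc (sign ∣ X ∣) _ _) ⟩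
  sign ∣ X ∣ * sign ∣ X ∣ * χ (X ≟S Y)      ≡⟨ cong (_* χ (X ≟S Y)) (sign-*-sign ∣ X ∣) ⟩
  + 1 * χ (X ≟S Y)                          ≡⟨ *-identityˡ _ ⟩
  χ (X ≟S Y)                                ∎
  where open ≡-Reasoning

alternating-intervalʳ : ∀ {m} (X Y : Subset m) →
                        ∑[ U ← allSubsets m ] sign (∣ Y ∣ ℕ.+ ∣ U ∣) * (χ (X ⊆? U) * χ (U ⊆? Y)) ≡ χ (X ≟S Y)
alternating-intervalʳ X Y = trans (∑-sign-interval Y X Y) (sign-sign-χ X Y)

module _ {m : ℕ} where

  coeff-⊗ : ∀ (M N : Mat m) S T k → coeff k ((M ⊗ N) S T) ≡ ∑[ U ← allSubsets m ] coeff k (M S U *L N U T)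
  coeff-⊗ M N S T k = coeff-ΣL k (allSubsets m) _

  -- A record, so that a proof of M ≋ N determines M and N for Agda's inference.
  infix 4 _≋_
  record _≋_ (M N : Mat m) : Set where
    constructor mk≋
    field ≋⇒≈M : M ≈M N
  open _≋_ public

  ≋-setoid : Setoid _ _
  ≋-setoid = record
    { Carrier       = Mat m
    ; _≈_           = _≋_
    ; isEquivalence = record
      { refl  = mk≋ λ S T k → refl
      ; sym   = λ (mk≋ M≈N) → mk≋ λ S T k → sym (M≈N S T k)
      ; trans = λ (mk≋ M≈N) (mk≋ N≈P) → mk≋ λ S T k → trans (M≈N S T k) (N≈P S T k)
      }
    }

  open Setoid ≋-setoid public using () renaming (refl to ≋-refl; sym to ≋-sym; trans to ≋-trans)

  ⊗-congˡ : ∀ {M M′ : Mat m} (N : Mat m) → M ≋ M′ → M ⊗ N ≋ M′ ⊗ N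
  ⊗-congˡ {M} {M′} N (mk≋ M≈M′) = mk≋ λ S T k → begin
    coeff k ((M ⊗ N) S T)
      ≡⟨ coeff-⊗ M N S T k ⟩
    ∑[ U ← allSubsets m ] coeff k (M S U *L N U T)
      ≡⟨ ∑-ext (allSubsets m) (λ U → *L-congˡ {M S U} {M′ S U} (N U T) (M≈M′ S U) k) ⟩
    ∑[ U ← allSubsets m ] coeff k (M′ S U *L N U T)
      ≡⟨ sym (coeff-⊗ M′ N S T k) ⟩
    coeff k ((M′ ⊗ N) S T) ∎
    where open ≡-Reasoning

  ⊗-congʳ : ∀ (M : Mat m) {N N′ : Mat m} → N ≋ N′ → M ⊗ N ≋ M ⊗ N′
  ⊗-congʳ M {N} {N′} (mk≋ N≈N′) = mk≋ λ S T k → begin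
    coeff k ((M ⊗ N) S T)
      ≡⟨ coeff-⊗ M N S T k ⟩
    ∑[ U ← allSubsets m ] coeff k (M S U *L N U T)
      ≡⟨ ∑-ext (allSubsets m) (λ U → *L-congʳ (M S U) {N U T} {N′ U T} (N≈N′ U T) k) ⟩
    ∑[ U ← allSubsets m ] coeff k (M S U *L N′ U T)
      ≡⟨ sym (coeff-⊗ M N′ S T k) ⟩
    coeff k ((M ⊗ N′) S T) ∎
    where open ≡-Reasoning

  ⊗-cong : ∀ {M M′ N N′ : Mat m} → M ≋ M′ → N ≋ N′ → M ⊗ N ≋ M′ ⊗ N′
  ⊗-cong {M′ = M′} {N = N} M≋M′ N≋N′ = ≋-trans (⊗-congˡ N M≋M′) (⊗-congʳ M′ N≋N′)

  ⊗-assoc : ∀ (M N P : Mat m) → (M ⊗ N) ⊗ P ≋ M ⊗ (N ⊗ P)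
  ⊗-assoc M N P = mk≋ λ S T k → begin
    coeff k (((M ⊗ N) ⊗ P) S T)
      ≡⟨ coeff-⊗ (M ⊗ N) P S T k ⟩
    ∑[ V ← allSubsets m ] coeff k ((M ⊗ N) S V *L P V T)
      ≡⟨ ∑-ext (allSubsets m) (λ V → ΣL-*L (allSubsets m) _ (P V T) k) ⟩
    ∑[ V ← allSubsets m ] coeff k (ΣL (allSubsets m) (λ U → (M S U *L N U V) *L P V T))
      ≡⟨ ∑-ext (allSubsets m) (λ V → coeff-ΣL k (allSubsets m) _) ⟩
    ∑[ V ← allSubsets m ] ∑[ U ← allSubsets m ] coeff k ((M S U *L N U V) *L P V T)
      ≡⟨ ∑-comm (allSubsets m) (allSubsets m) _ ⟩
    ∑[ U ← allSubsets m ] ∑[ V ← allSubsets m ] coeff k ((M S U *L N U V) *L P V T)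
      ≡⟨ ∑-ext (allSubsets m) (λ U → ∑-ext (allSubsets m) (λ V → *L-assoc (M S U) (N U V) (P V T) k)) ⟩
    ∑[ U ← allSubsets m ] ∑[ V ← allSubsets m ] coeff k (M S U *L (N U V *L P V T))
      ≡⟨ ∑-ext (allSubsets m) (λ U → sym (coeff-ΣL k (allSubsets m) _)) ⟩
    ∑[ U ← allSubsets m ] coeff k (ΣL (allSubsets m) (λ V → M S U *L (N U V *L P V T)))
      ≡⟨ ∑-ext (allSubsets m) (λ U → sym (*L-ΣL (allSubsets m) _ (M S U) k)) ⟩
    ∑[ U ← allSubsets m ] coeff k (M S U *L (N ⊗ P) U T)
      ≡⟨ sym (coeff-⊗ M (N ⊗ P) S T k) ⟩
    coeff k ((M ⊗ (N ⊗ P)) S T) ∎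
    where open ≡-Reasoning

  scalar : (Subset m → Subset m → ℤ) → Mat m
  scalar c S T = c S T ·L 1L

  coeff-scalar : ∀ c (S T : Subset m) k → coeff k (scalar c S T) ≡ c S T * χ (+ 0 ≟ℤ k)
  coeff-scalar c S T k = trans (coeff-·L k (c S T) 1L) (cong (c S T *_) (coeff-qpow k (+ 0)))

  ⊗-scalarʳ : ∀ (M : Mat m) c S T k → coeff k ((M ⊗ scalar c) S T) ≡ ∑[ U ← allSubsets m ] coeff k (M S U) * c U T
  ⊗-scalarʳ M c S T k = begin
    coeff k ((M ⊗ scalar c) S T)
      ≡⟨ coeff-⊗ M (scalar c) S T k ⟩
    ∑[ U ← allSubsets m ] coeff k (M S U *L (c U T ·L 1L))
      ≡⟨ ∑-ext (allSubsets m) (λ U → *L-·L (c U T) (M S U) 1L k) ⟩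
    ∑[ U ← allSubsets m ] coeff k (c U T ·L (M S U *L 1L))
      ≡⟨ ∑-ext (allSubsets m) (λ U → coeff-·L k (c U T) (M S U *L 1L)) ⟩
    ∑[ U ← allSubsets m ] c U T * coeff k (M S U *L 1L)
      ≡⟨ ∑-ext (allSubsets m) (λ U → cong (c U T *_) (*L-identityʳ (M S U) k)) ⟩
    ∑[ U ← allSubsets m ] c U T * coeff k (M S U)
      ≡⟨ ∑-ext (allSubsets m) (λ U → *-comm (c U T) _) ⟩
    ∑[ U ← allSubsets m ] coeff k (M S U) * c U T ∎
    where open ≡-Reasoning

  ⊗-scalarˡ : ∀ (M : Mat m) c S T k → coeff k ((scalar c ⊗ M) S T) ≡ ∑[ U ← allSubsets m ] c S U * coeff k (M U T)
  ⊗-scalarˡ M c S T k = begin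
    coeff k ((scalar c ⊗ M) S T)
      ≡⟨ coeff-⊗ (scalar c) M S T k ⟩
    ∑[ U ← allSubsets m ] coeff k ((c S U ·L 1L) *L M U T)
      ≡⟨ ∑-ext (allSubsets m) (λ U → ·L-*L (c S U) 1L (M U T) k) ⟩
    ∑[ U ← allSubsets m ] coeff k (c S U ·L (1L *L M U T))
      ≡⟨ ∑-ext (allSubsets m) (λ U → coeff-·L k (c S U) (1L *L M U T)) ⟩
    ∑[ U ← allSubsets m ] c S U * coeff k (1L *L M U T)
      ≡⟨ ∑-ext (allSubsets m) (λ U → cong (c S U *_) (*L-identityˡ (M U T) k)) ⟩
    ∑[ U ← allSubsets m ] c S U * coeff k (M U T) ∎
    where open ≡-Reasoning

  δ : Mat m
  δ = scalar (λ S T → χ (S ≟S T))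

  Id≈δ : Id ≈M δ
  Id≈δ S T k with does (S ≟S T)
  ... | true  = refl
  ... | false = sym (coeff-·L k (+ 0) 1L)

  Id≋δ : Id ≋ δ
  Id≋δ = mk≋ Id≈δ

  ⊗-identityˡ : ∀ (M : Mat m) → Id ⊗ M ≋ M
  ⊗-identityˡ M = mk≋ λ S T k → begin
    coeff k ((Id ⊗ M) S T)
      ≡⟨ ≋⇒≈M (⊗-congˡ M Id≋δ) S T k ⟩
    coeff k ((δ ⊗ M) S T)
      ≡⟨ ⊗-scalarˡ M (λ S T → χ (S ≟S T)) S T k ⟩
    ∑[ U ← allSubsets m ] χ (S ≟S U) * coeff k (M U T)
      ≡⟨ ∑-ext (allSubsets m) (λ U → cong (_* coeff k (M U T)) (χ-≡-sym (S ≟S U) (U ≟S S))) ⟩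
    ∑[ U ← allSubsets m ] χ (U ≟S S) * coeff k (M U T)
      ≡⟨ ∑-δ _≟S_ allSubsets-unique (∈-allSubsets S) (λ U → coeff k (M U T)) ⟩
    coeff k (M S T) ∎
    where open ≡-Reasoning

  scalar-⊗-scalar : ∀ (c d : Subset m → Subset m → ℤ) →
                    scalar c ⊗ scalar d ≋ scalar (λ S T → ∑[ U ← allSubsets m ] c S U * d U T)
  scalar-⊗-scalar c d = mk≋ λ S T k → begin
    coeff k ((scalar c ⊗ scalar d) S T)
      ≡⟨ ⊗-scalarˡ (scalar d) c S T k ⟩
    ∑[ U ← allSubsets m ] c S U * coeff k (scalar d U T)
      ≡⟨ ∑-ext (allSubsets m) (λ U → cong (c S U *_) (coeff-scalar d U T k)) ⟩
    ∑[ U ← allSubsets m ] c S U * (d U T * χ (+ 0 ≟ℤ k))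
      ≡⟨ ∑-ext (allSubsets m) (λ U → sym (*-assoc (c S U) _ _)) ⟩
    ∑[ U ← allSubsets m ] c S U * d U T * χ (+ 0 ≟ℤ k)
      ≡⟨ ∑-*ʳ (allSubsets m) (χ (+ 0 ≟ℤ k)) (λ U → c S U * d U T) ⟩
    (∑[ U ← allSubsets m ] c S U * d U T) * χ (+ 0 ≟ℤ k)
      ≡⟨ sym (coeff-scalar (λ S T → ∑[ U ← allSubsets m ] c S U * d U T) S T k) ⟩
    coeff k (scalar (λ S T → ∑[ U ← allSubsets m ] c S U * d U T) S T) ∎
    where open ≡-Reasoning

  coeff-signedRecip : ∀ (M : Mat m) S T k → coeff k (signedRecip M S T) ≡ sign (∣ S ∣ ℕ.+ ∣ T ∣) * coeff (- k) (M S T)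
  coeff-signedRecip M S T k =
    trans (coeff-·L k (sign (∣ S ∣ ℕ.+ ∣ T ∣)) (recip (M S T))) (cong (sign (∣ S ∣ ℕ.+ ∣ T ∣) *_) (coeff-recip k (M S T)))

  signedRecip-cong : ∀ {M N : Mat m} → M ≋ N → signedRecip M ≋ signedRecip N
  signedRecip-cong {M} {N} (mk≋ M≈N) = mk≋ λ S T k → begin
    coeff k (signedRecip M S T)                   ≡⟨ coeff-signedRecip M S T k ⟩
    sign (∣ S ∣ ℕ.+ ∣ T ∣) * coeff (- k) (M S T)  ≡⟨ cong (sign (∣ S ∣ ℕ.+ ∣ T ∣) *_) (M≈N S T (- k)) ⟩
    sign (∣ S ∣ ℕ.+ ∣ T ∣) * coeff (- k) (N S T)  ≡⟨ sym (coeff-signedRecip N S T k) ⟩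
    coeff k (signedRecip N S T)                   ∎
    where open ≡-Reasoning

  signedRecip-⊗ : ∀ (M N : Mat m) → signedRecip (M ⊗ N) ≋ signedRecip M ⊗ signedRecip N
  signedRecip-⊗ M N = mk≋ pointwise
    where
    pointwise : ∀ S T k → coeff k (signedRecip (M ⊗ N) S T) ≡ coeff k ((signedRecip M ⊗ signedRecip N) S T)
    pointwise S T k = begin
      coeff k (signedRecip (M ⊗ N) S T)
        ≡⟨ coeff-signedRecip (M ⊗ N) S T k ⟩
      σ S T * coeff (- k) ((M ⊗ N) S T)
        ≡⟨ cong (σ S T *_) (coeff-⊗ M N S T (- k)) ⟩
      σ S T * (∑[ U ← allSubsets m ] coeff (- k) (M S U *L N U T))
        ≡⟨ sym (∑-*ˡ (allSubsets m) (σ S T) _) ⟩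
      ∑[ U ← allSubsets m ] σ S T * coeff (- k) (M S U *L N U T)
        ≡⟨ ∑-ext (allSubsets m) term-at ⟩
      ∑[ U ← allSubsets m ] coeff k (signedRecip M S U *L signedRecip N U T)
        ≡⟨ sym (coeff-⊗ (signedRecip M) (signedRecip N) S T k) ⟩
      coeff k ((signedRecip M ⊗ signedRecip N) S T) ∎
      where
      open ≡-Reasoning
      σ : Subset m → Subset m → ℤ
      σ S T = sign (∣ S ∣ ℕ.+ ∣ T ∣)
      term-at : ∀ U → σ S T * coeff (- k) (M S U *L N U T) ≡ coeff k (signedRecip M S U *L signedRecip N U T)
      term-at U = sym (begin
        coeff k ((σ S U ·L recip (M S U)) *L (σ U T ·L recip (N U T)))
          ≡⟨ ·L-*L (σ S U) (recip (M S U)) (σ U T ·L recip (N U T)) k ⟩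
        coeff k (σ S U ·L (recip (M S U) *L (σ U T ·L recip (N U T))))
          ≡⟨ coeff-·L k (σ S U) (recip (M S U) *L (σ U T ·L recip (N U T))) ⟩
        σ S U * coeff k (recip (M S U) *L (σ U T ·L recip (N U T)))
          ≡⟨ cong (σ S U *_) (*L-·L (σ U T) (recip (M S U)) (recip (N U T)) k) ⟩
        σ S U * coeff k (σ U T ·L (recip (M S U) *L recip (N U T)))
          ≡⟨ cong (σ S U *_) (coeff-·L k (σ U T) (recip (M S U) *L recip (N U T))) ⟩
        σ S U * (σ U T * coeff k (recip (M S U) *L recip (N U T)))
          ≡⟨ sym (*-assoc (σ S U) (σ U T) _) ⟩
        σ S U * σ U T * coeff k (recip (M S U) *L recip (N U T))
          ≡⟨ cong₂ _*_ (sign-+-+ (∣ S ∣) (∣ U ∣) (∣ T ∣)) (sym (recip-*L (M S U) (N U T) k)) ⟩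
        σ S T * coeff k (recip (M S U *L N U T))
          ≡⟨ cong (σ S T *_) (coeff-recip k (M S U *L N U T)) ⟩
        σ S T * coeff (- k) (M S U *L N U T) ∎)

  scalar-cong : ∀ {c d : Subset m → Subset m → ℤ} → (∀ S T → c S T ≡ d S T) → scalar c ≋ scalar d
  scalar-cong c≗d = mk≋ λ S T k → cong (λ x → coeff k (x ·L 1L)) (c≗d S T)

  signedRecip-scalar : ∀ c → signedRecip (scalar c) ≋ scalar (λ S T → sign (∣ S ∣ ℕ.+ ∣ T ∣) * c S T)
  signedRecip-scalar c = mk≋ pointwise
    where
    pointwise : ∀ S T k → coeff k (signedRecip (scalar c) S T) ≡ coeff k (scalar (λ S T → sign (∣ S ∣ ℕ.+ ∣ T ∣) * c S T) S T)
    pointwise S T k = begin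
      coeff k (signedRecip (scalar c) S T)
        ≡⟨ coeff-signedRecip (scalar c) S T k ⟩
      σ * coeff (- k) (scalar c S T)
        ≡⟨ cong (σ *_) (coeff-scalar c S T (- k)) ⟩
      σ * (c S T * χ (+ 0 ≟ℤ - k))
        ≡⟨ cong (λ x → σ * (c S T * x)) (χ-0≟-k k) ⟩
      σ * (c S T * χ (+ 0 ≟ℤ k))
        ≡⟨ sym (*-assoc σ (c S T) _) ⟩
      σ * c S T * χ (+ 0 ≟ℤ k)
        ≡⟨ sym (coeff-scalar (λ S T → sign (∣ S ∣ ℕ.+ ∣ T ∣) * c S T) S T k) ⟩
      coeff k (scalar (λ S T → sign (∣ S ∣ ℕ.+ ∣ T ∣) * c S T) S T) ∎
      where
      open ≡-Reasoning
      σ : ℤ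
      σ = sign (∣ S ∣ ℕ.+ ∣ T ∣)

  IsInverse-cong : ∀ {M M′ N N′ : Mat m} → M ≋ M′ → N ≋ N′ → IsInverse M N → IsInverse M′ N′
  IsInverse-cong {M} {M′} {N} {N′} M≋M′ N≋N′ (MN≈Id , NM≈Id) =
    ≋⇒≈M (≋-trans (⊗-cong (≋-sym M≋M′) (≋-sym N≋N′)) (mk≋ {M ⊗ N} {Id} MN≈Id)) ,
    ≋⇒≈M (≋-trans (⊗-cong (≋-sym N≋N′) (≋-sym M≋M′)) (mk≋ {N ⊗ M} {Id} NM≈Id))

  IsInverse-⊗ : ∀ {M M′ N N′ : Mat m} → IsInverse M M′ → IsInverse N N′ → IsInverse (M ⊗ N) (N′ ⊗ M′)
  IsInverse-⊗ {M} {M′} {N} {N′} (MM′≈Id , M′M≈Id) (NN′≈Id , N′N≈Id) =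
    cancel M N N′ M′ (mk≋ {N ⊗ N′} NN′≈Id) (mk≋ {M ⊗ M′} MM′≈Id) ,
    cancel N′ M′ M N (mk≋ {M′ ⊗ M} M′M≈Id) (mk≋ {N′ ⊗ N} N′N≈Id)
    where
    open import Relation.Binary.Reasoning.Setoid ≋-setoid
    cancel : ∀ P Q R S → Q ⊗ R ≋ Id → P ⊗ S ≋ Id → ((P ⊗ Q) ⊗ (R ⊗ S)) ≈M Id
    cancel P Q R S QR≋Id PS≋Id = ≋⇒≈M (begin
      (P ⊗ Q) ⊗ (R ⊗ S)   ≈⟨ ⊗-assoc P Q (R ⊗ S) ⟩
      P ⊗ (Q ⊗ (R ⊗ S))   ≈⟨ ⊗-congʳ P (≋-sym (⊗-assoc Q R S)) ⟩
      P ⊗ ((Q ⊗ R) ⊗ S)   ≈⟨ ⊗-congʳ P (⊗-congˡ S QR≋Id) ⟩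
      P ⊗ (Id ⊗ S)        ≈⟨ ⊗-congʳ P (⊗-identityˡ S) ⟩
      P ⊗ S               ≈⟨ PS≋Id ⟩
      Id                  ∎)

module _ {m : ℕ} where

  ζ-entry μ-entry : Subset m → Subset m → ℤ
  ζ-entry S T = χ (T ⊆? S)
  μ-entry S T = sign (∣ S ∣ ℕ.+ ∣ T ∣) * χ (T ⊆? S)

  ζ μ : Mat m
  ζ = scalar ζ-entry
  μ = scalar μ-entry

  ζ-μ-inverse : IsInverse ζ μ
  ζ-μ-inverse = ≋⇒≈M (≋-trans (scalar-⊗-scalar ζ-entry μ-entry) (≋-trans (scalar-cong ζμ) (≋-sym Id≋δ)))
              , ≋⇒≈M (≋-trans (scalar-⊗-scalar μ-entry ζ-entry) (≋-trans (scalar-cong μζ) (≋-sym Id≋δ)))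
    where
    ζμ : ∀ S T → ∑[ U ← allSubsets m ] χ (U ⊆? S) * (sign (∣ U ∣ ℕ.+ ∣ T ∣) * χ (T ⊆? U)) ≡ χ (S ≟S T)
    ζμ S T = begin
      ∑[ U ← allSubsets m ] χ (U ⊆? S) * (sign (∣ U ∣ ℕ.+ ∣ T ∣) * χ (T ⊆? U))
        ≡⟨ ∑-ext (allSubsets m) (λ U → x∙yz≈y∙zx (χ (U ⊆? S)) (sign (∣ U ∣ ℕ.+ ∣ T ∣)) (χ (T ⊆? U))) ⟩
      ∑[ U ← allSubsets m ] sign (∣ U ∣ ℕ.+ ∣ T ∣) * (χ (T ⊆? U) * χ (U ⊆? S))
        ≡⟨ alternating-intervalˡ T S ⟩
      χ (T ≟S S)
        ≡⟨ χ-≡-sym (T ≟S S) (S ≟S T) ⟩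
      χ (S ≟S T) ∎
      where open ≡-Reasoning
    μζ : ∀ S T → ∑[ U ← allSubsets m ] sign (∣ S ∣ ℕ.+ ∣ U ∣) * χ (U ⊆? S) * χ (T ⊆? U) ≡ χ (S ≟S T)
    μζ S T = begin
      ∑[ U ← allSubsets m ] sign (∣ S ∣ ℕ.+ ∣ U ∣) * χ (U ⊆? S) * χ (T ⊆? U)
        ≡⟨ ∑-ext (allSubsets m) (λ U → xy∙z≈x∙zy (sign (∣ S ∣ ℕ.+ ∣ U ∣)) (χ (U ⊆? S)) (χ (T ⊆? U))) ⟩
      ∑[ U ← allSubsets m ] sign (∣ S ∣ ℕ.+ ∣ U ∣) * (χ (T ⊆? U) * χ (U ⊆? S))
        ≡⟨ alternating-intervalʳ T S ⟩
      χ (T ≟S S)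
        ≡⟨ χ-≡-sym (T ≟S S) (S ≟S T) ⟩
      χ (S ≟S T) ∎
      where open ≡-Reasoning

  signedRecip-μ : signedRecip μ ≋ ζ
  signedRecip-μ = ≋-trans (signedRecip-scalar μ-entry) (scalar-cong sign-sign)
    where
    sign-sign : ∀ S T → sign (∣ S ∣ ℕ.+ ∣ T ∣) * (sign (∣ S ∣ ℕ.+ ∣ T ∣) * χ (T ⊆? S)) ≡ χ (T ⊆? S)
    sign-sign S T = trans (sym (*-assoc (sign (∣ S ∣ ℕ.+ ∣ T ∣)) _ _))
                          (trans (cong (_* χ (T ⊆? S)) (sign-*-sign (∣ S ∣ ℕ.+ ∣ T ∣))) (*-identityˡ _))

infixl 10 _!_
_!_ : Perm m → Fin (suc m) → Fin (suc m)
_!_ = lookup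

infixr 9 _∘ₚ_
_∘ₚ_ : Perm m → Perm m → Perm m
u ∘ₚ v = tabulate (λ i → u ! (v ! i))

idₚ : Perm m
idₚ = tabulate (λ i → i)

!-∘ₚ : ∀ (u v : Perm m) i → (u ∘ₚ v) ! i ≡ u ! (v ! i)
!-∘ₚ u v = lookup∘tabulate (λ i → u ! (v ! i))

!-idₚ : ∀ (i : Fin (suc m)) → idₚ ! i ≡ i
!-idₚ = lookup∘tabulate (λ i → i)

Perm-ext : ∀ {u w : Perm m} → (∀ i → u ! i ≡ w ! i) → u ≡ w
Perm-ext {u = u} {w} u≗w = trans (sym (tabulate∘lookup u)) (trans (tabulate-cong u≗w) (tabulate∘lookup w))

idₚ-perm : IsPerm (idₚ {m})
idₚ-perm i j eq = trans (sym (!-idₚ i)) (trans eq (!-idₚ j))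

∘ₚ-perm : ∀ (u v : Perm m) → IsPerm u → IsPerm v → IsPerm (u ∘ₚ v)
∘ₚ-perm u v u-perm v-perm i j eq =
  v-perm i j (u-perm _ _ (trans (sym (!-∘ₚ u v i)) (trans eq (!-∘ₚ u v j))))

∘ₚ-idₚ : ∀ (u : Perm m) → u ∘ₚ idₚ ≡ u
∘ₚ-idₚ u = Perm-ext (λ i → trans (!-∘ₚ u idₚ i) (cong (u !_) (!-idₚ i)))

no-injection-below : ∀ {k} (f : Fin (suc k) → Fin n) → (∀ {i j} → f i ≡ f j → i ≡ j) → ¬ (∀ i → toℕ (f i) ℕ.< k)
no-injection-below {k = k} f f-inj bounded = ℕₚ.1+n≰n (injective⇒≤ {f = squeeze} squeeze-injective)
  where
  squeeze : Fin (suc k) → Fin k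
  squeeze i = fromℕ< (bounded i)
  squeeze-injective : ∀ {i j} → squeeze i ≡ squeeze j → i ≡ j
  squeeze-injective eq =
    f-inj (toℕ-injective (trans (sym (toℕ-fromℕ< (bounded _))) (trans (cong toℕ eq) (toℕ-fromℕ< (bounded _)))))

module _ (w : Perm m) (w-perm : IsPerm w) where

  preimage : ∀ a → ∃ λ j → w ! j ≡ a
  preimage a with any? (λ j → w ! j ≟F a)
  ... | yes found  = found
  ... | no missing = contradiction (injective⇒≤ punched-injective) ℕₚ.1+n≰n
    where
    a≢ : ∀ j → a ≢ w ! j
    a≢ j eq = missing (j , sym eq)
    punched-injective : ∀ {i j} → punchOut (a≢ i) ≡ punchOut (a≢ j) → i ≡ j
    punched-injective eq = w-perm _ _ (punchOut-injective (a≢ _) (a≢ _) eq)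

  inverse : Fin (suc m) → Fin (suc m)
  inverse a = proj₁ (preimage a)

  !-inverse : ∀ a → w ! inverse a ≡ a
  !-inverse a = proj₂ (preimage a)

  inverse-! : ∀ j → inverse (w ! j) ≡ j
  inverse-! j = w-perm _ _ (!-inverse (w ! j))

module _ (v : Perm m) (v-perm : IsPerm v) (c : Fin m) (cut : IsCut v c) where

  private
    v⁻¹ : Fin (suc m) → Fin (suc m)
    v⁻¹ = inverse v v-perm

    !-v⁻¹ : ∀ a → v ! v⁻¹ a ≡ a
    !-v⁻¹ = !-inverse v v-perm

    upTo : Fin (suc (toℕ c)) → Fin (suc m)
    upTo i = inject≤ i (ℕₚ.m≤n⇒m≤1+n (toℕ<n c))

    upTo-≤ : ∀ i → upTo i ≤ c
    upTo-≤ i = subst (ℕ._≤ toℕ c) (sym (toℕ-inject≤ i _)) (ℕₚ.≤-pred (toℕ<n i))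

    upTo-injective : ∀ {i j} → upTo i ≡ upTo j → i ≡ j
    upTo-injective eq = toℕ-injective (trans (sym (toℕ-inject≤ _ _)) (trans (cong toℕ eq) (toℕ-inject≤ _ _)))

  inverse-≤ : ∀ {a} → a ≤ c → inverse v v-perm a ≤ c
  inverse-≤ {a} a≤c with v⁻¹ a Fin.≤? c
  ... | yes j≤c = j≤c
  ... | no  j≰c = contradiction below-c (no-injection-below (v !_ ∘ upTo) (upTo-injective ∘ v-perm _ _))
    where
    below-c : ∀ i → v ! upTo i < c
    below-c i = ℕₚ.<-≤-trans (subst (λ b → v ! upTo i < b) (!-v⁻¹ a) (cut _ _ (upTo-≤ i) (ℕₚ.≰⇒> j≰c))) a≤c

  cut-≤ : ∀ {j} → j ≤ c → v ! j ≤ c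
  cut-≤ {j} j≤c with v ! j Fin.≤? c
  ... | yes vj≤c = vj≤c
  ... | no  vj≰c = contradiction bounded (no-injection-below f f-injective)
    where
    f : Fin (suc (suc (toℕ c))) → Fin (suc m)
    f Fin.zero    = j
    f (Fin.suc i) = v⁻¹ (upTo i)
    j≢ : ∀ i → j ≢ v⁻¹ (upTo i)
    j≢ i eq = vj≰c (subst (_≤ c) (sym (trans (cong (v !_) eq) (!-v⁻¹ (upTo i)))) (upTo-≤ i))
    f-injective : ∀ {i i′} → f i ≡ f i′ → i ≡ i′
    f-injective {Fin.zero}  {Fin.zero}   eq = refl
    f-injective {Fin.zero}  {Fin.suc i′} eq = contradiction eq (j≢ i′)
    f-injective {Fin.suc i} {Fin.zero}   eq = contradiction (sym eq) (j≢ i)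
    f-injective {Fin.suc i} {Fin.suc i′} eq =
      cong Fin.suc (upTo-injective (trans (sym (!-v⁻¹ (upTo i))) (trans (cong (v !_) eq) (!-v⁻¹ (upTo i′)))))
    bounded : ∀ i → toℕ (f i) ℕ.< suc (toℕ c)
    bounded Fin.zero    = s≤s j≤c
    bounded (Fin.suc i) = s≤s (inverse-≤ (upTo-≤ i))

  cut-> : ∀ {k} → c < k → c < v ! k
  cut-> {k} c<k with v ! k Fin.≤? c
  ... | no  vk≰c = ℕₚ.≰⇒> vk≰c
  ... | yes vk≤c = contradiction (subst (_≤ c) (inverse-! v v-perm k) (inverse-≤ vk≤c)) (ℕₚ.<⇒≱ c<k)

∈-tabulate-does : {P : Pred (Fin n) p} (P? : Decidable P) {i : Fin n} → i ∈ tabulate (λ j → does (P? j)) ⇔ P i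
∈-tabulate-does {P = P} P? {i} = mk⇔ to from
  where
  to : i ∈ tabulate (λ j → does (P? j)) → P i
  to i∈ with P? i | trans (sym (lookup∘tabulate (λ j → does (P? j)) i)) ([]=⇒lookup i∈)
  ... | yes Pi | _ = Pi
  from : P i → i ∈ tabulate (λ j → does (P? j))
  from Pi = lookup⇒[]= i _ (trans (lookup∘tabulate (λ j → does (P? j)) i) (dec-true (P? i) Pi))

∈C⇔IsCut : ∀ {w : Perm m} {c} → c ∈ C w ⇔ IsCut w c
∈C⇔IsCut {w = w} = ∈-tabulate-does (isCut? w)

∈D⇔IsDescent : ∀ {w : Perm m} {c} → c ∈ D w ⇔ IsDescent w c
∈D⇔IsDescent {w = w} = ∈-tabulate-does (descent? w)

IsCut⇒∈C : ∀ (w : Perm m) {c} → IsCut w c → c ∈ C w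
IsCut⇒∈C w = Equivalence.from (∈C⇔IsCut {w = w})

IsDescent⇒∈D : ∀ (w : Perm m) {c} → IsDescent w c → c ∈ D w
IsDescent⇒∈D w = Equivalence.from (∈D⇔IsDescent {w = w})

∈D⇒IsDescent : ∀ (w : Perm m) {c} → c ∈ D w → IsDescent w c
∈D⇒IsDescent w = Equivalence.to (∈D⇔IsDescent {w = w})

cut-outside : ∀ {S : Subset m} (w : Perm m) → ∁ S ⊆ C w → ∀ {c} → c ∉ S → IsCut w c
cut-outside w ∁S⊆Cw c∉S = Equivalence.to (∈C⇔IsCut {w = w}) (∁S⊆Cw (x∉p⇒x∈∁p c∉S))

descent-at : ∀ {T : Subset m} (w : Perm m) → T ⊆ D w → ∀ {c} → c ∈ T → IsDescent w c
descent-at w T⊆Dw c∈T = Equivalence.to (∈D⇔IsDescent {w = w}) (T⊆Dw c∈T)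

cut⇒¬descent : ∀ (w : Perm m) c → IsCut w c → ¬ IsDescent w c
cut⇒¬descent w c cut = ℕₚ.<⇒≯ (cut (inject₁ c) (Fin.suc c) (ℕₚ.≤-reflexive (toℕ-inject₁ c)) ℕₚ.≤-refl)

adjacent-chain : (R : Fin (suc m) → Fin (suc m) → Set) →
                 (∀ {a b c} → a < b → b < c → R a b → R b c → R a c) →
                 (∀ g → R (inject₁ g) (Fin.suc g)) →
                 ∀ {a b} → a < b → R a b
adjacent-chain {m} R R-trans R-adjacent {b = b} = go (toℕ b) refl
  where
  go : ∀ d {a b} → toℕ b ≡ d → a < b → R a b
  go d {b = Fin.zero} _ ()
  go (suc d) {a} {Fin.suc g} b≡1+d a<b with ℕₚ.m≤n⇒m<n∨m≡n (ℕₚ.≤-pred a<b)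
  ... | inj₂ a≡g = subst (λ x → R x (Fin.suc g)) (toℕ-injective (trans (toℕ-inject₁ g) (sym a≡g))) (R-adjacent g)
  ... | inj₁ a<g = R-trans a<g′ g′<b (go d (trans (toℕ-inject₁ g) (ℕₚ.suc-injective b≡1+d)) a<g′) (R-adjacent g)
    where
    a<g′ : a < inject₁ g
    a<g′ = subst (toℕ a ℕ.<_) (sym (toℕ-inject₁ g)) a<g
    g′<b : inject₁ g < Fin.suc g
    g′<b = ℕₚ.≤-reflexive (cong suc (toℕ-inject₁ g))

-- a and b lie in the same block of the Young subgroup 𝔖_T: no gap outside T separates them.
SameBlock : Subset m → Fin (suc m) → Fin (suc m) → Set
SameBlock T a b = ∀ {c} → c ∉ T → (a ≤ c → b ≤ c) × (b ≤ c → a ≤ c)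

module _ {T : Subset m} where

  block-sym : ∀ {a b} → SameBlock T a b → SameBlock T b a
  block-sym a~b c∉T = proj₂ (a~b c∉T) , proj₁ (a~b c∉T)

  block-trans : ∀ {a b d} → SameBlock T a b → SameBlock T b d → SameBlock T a d
  block-trans a~b b~d c∉T = proj₁ (b~d c∉T) ∘ proj₁ (a~b c∉T) , proj₂ (a~b c∉T) ∘ proj₂ (b~d c∉T)

  block-between : ∀ {a b d} → a ≤ b → b ≤ d → SameBlock T a d → SameBlock T a b × SameBlock T b d
  block-between a≤b b≤d a~d =
    (λ c∉T → (λ a≤c → ℕₚ.≤-trans b≤d (proj₁ (a~d c∉T) a≤c)) , ℕₚ.≤-trans a≤b) ,
    (λ c∉T → (λ b≤c → proj₁ (a~d c∉T) (ℕₚ.≤-trans a≤b b≤c)) , (λ d≤c → ℕₚ.≤-trans b≤d d≤c))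

  adjacent-block : ∀ {g} → SameBlock T (inject₁ g) (Fin.suc g) → g ∈ T
  adjacent-block {g} g~g+1 with g ∈? T
  ... | yes g∈T = g∈T
  ... | no  g∉T = contradiction (proj₁ (g~g+1 g∉T) (ℕₚ.≤-reflexive (toℕ-inject₁ g))) ℕₚ.1+n≰n

  gap-block : ∀ {g} → g ∈ T → SameBlock T (inject₁ g) (Fin.suc g)
  gap-block {g} g∈T {c} c∉T = forward , backward
    where
    forward : inject₁ g ≤ c → Fin.suc g ≤ c
    forward g≤c = ℕₚ.≤∧≢⇒< (subst (ℕ._≤ toℕ c) (toℕ-inject₁ g) g≤c)
                           (λ g≡c → c∉T (subst (_∈ T) (toℕ-injective g≡c) g∈T))
    backward : Fin.suc g ≤ c → inject₁ g ≤ c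
    backward g<c = subst (ℕ._≤ toℕ c) (sym (toℕ-inject₁ g)) (ℕₚ.<⇒≤ g<c)

  Separated : Fin (suc m) → Fin (suc m) → Set
  Separated a b = ∃ λ c → c ∉ T × a ≤ c × c < b

  separated-or-block : ∀ {a b} → a < b → Separated a b ⊎ SameBlock T a b
  separated-or-block {a} {b} a<b with any? (λ c → ¬? (c ∈? T) ×-dec (a Fin.≤? c ×-dec c Fin.<? b))
  ... | yes (c , c∉T , a≤c , c<b) = inj₁ (c , c∉T , a≤c , c<b)
  ... | no  ¬separated = inj₂ λ {c} c∉T → forward c∉T , λ b≤c → ℕₚ.<⇒≤ (ℕₚ.<-≤-trans a<b b≤c)
    where
    forward : ∀ {c} → c ∉ T → a ≤ c → b ≤ c
    forward {c} c∉T a≤c with b Fin.≤? c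
    ... | yes b≤c = b≤c
    ... | no  b≰c = contradiction (c , c∉T , a≤c , ℕₚ.≰⇒> b≰c) ¬separated

  cut-block : ∀ (v : Perm m) → IsPerm v → ∁ T ⊆ C v → ∀ a → SameBlock T a (v ! a)
  cut-block v v-perm cuts a {c} c∉T = cut-≤ v v-perm c cut , backward
    where
    cut : IsCut v c
    cut = cut-outside v cuts c∉T
    backward : v ! a ≤ c → a ≤ c
    backward va≤c with a Fin.≤? c
    ... | yes a≤c = a≤c
    ... | no  a≰c = contradiction va≤c (ℕₚ.<⇒≱ (cut-> v v-perm c cut (ℕₚ.≰⇒> a≰c)))

  block-image : ∀ (v : Perm m) → IsPerm v → ∁ T ⊆ C v → ∀ {a b} → SameBlock T a b → SameBlock T (v ! a) (v ! b)
  block-image v v-perm cuts {a} {b} a~b =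
    block-trans (block-sym (cut-block v v-perm cuts a)) (block-trans a~b (cut-block v v-perm cuts b))

  separated-< : ∀ (v : Perm m) → ∁ T ⊆ C v → ∀ {a b} → Separated a b → v ! a < v ! b
  separated-< v cuts {a} {b} (c , c∉T , a≤c , c<b) = cut-outside v cuts c∉T a b a≤c c<b

  descending-block : ∀ (u : Perm m) → T ⊆ D u → ∀ {a b} → a < b → SameBlock T a b → u ! b < u ! a
  descending-block u descents = adjacent-chain (λ a b → SameBlock T a b → u ! b < u ! a) chain adjacent
    where
    chain : ∀ {a b d} → a < b → b < d → (SameBlock T a b → u ! b < u ! a) → (SameBlock T b d → u ! d < u ! b) →
            SameBlock T a d → u ! d < u ! a
    chain a<b b<d ab bd a~d with block-between (ℕₚ.<⇒≤ a<b) (ℕₚ.<⇒≤ b<d) a~d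
    ... | a~b , b~d = ℕₚ.<-trans (bd b~d) (ab a~b)
    adjacent : ∀ g → SameBlock T (inject₁ g) (Fin.suc g) → u ! Fin.suc g < u ! inject₁ g
    adjacent g g~g+1 = descent-at u descents (adjacent-block g~g+1)

inject₁≢suc : ∀ (g : Fin m) → inject₁ g ≢ Fin.suc g
inject₁≢suc g eq = ℕₚ.1+n≰n (ℕₚ.≤-reflexive (trans (cong toℕ (sym eq)) (toℕ-inject₁ g)))

¬descent⇒ascent : ∀ (w : Perm m) → IsPerm w → ∀ {g} → ¬ IsDescent w g → w ! inject₁ g < w ! Fin.suc g
¬descent⇒ascent w w-perm {g} ¬descent =
  ℕₚ.≤∧≢⇒< (ℕₚ.≮⇒≥ ¬descent) (λ eq → inject₁≢suc g (w-perm _ _ (toℕ-injective eq)))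

no-descent-increasing : ∀ (w : Perm m) → IsPerm w → (∀ g → ¬ IsDescent w g) → ∀ {a b} → a < b → w ! a < w ! b
no-descent-increasing w w-perm ascents =
  adjacent-chain (λ a b → w ! a < w ! b) (λ _ _ → ℕₚ.<-trans) (λ g → ¬descent⇒ascent w w-perm (ascents g))

count-below : ∀ {n} (b : Fin n) → ∑[ a ← allFin n ] χ (a Fin.<? b) ≡ + toℕ b
count-below {suc n} b = begin
  ∑[ a ← allFin (suc n) ] χ (a Fin.<? b)
    ≡⟨ cong (λ as → ∑[ a ← as ] χ (a Fin.<? b)) (cong (Fin.zero ∷_) (sym (map-tabulate (λ (i : Fin n) → i) Fin.suc))) ⟩
  χ (Fin.zero {n} Fin.<? b) + ∑ (map Fin.suc (allFin n)) (λ a → χ (a Fin.<? b))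
    ≡⟨ cong (_+_ (χ (Fin.zero {n} Fin.<? b))) (∑-map Fin.suc (allFin n) _) ⟩
  χ (Fin.zero {n} Fin.<? b) + (∑[ a ← allFin n ] χ (Fin.suc a Fin.<? b))
    ≡⟨ step b ⟩
  + toℕ b ∎
  where
  open ≡-Reasoning
  step : ∀ b → χ (Fin.zero {n} Fin.<? b) + (∑[ a ← allFin n ] χ (Fin.suc a Fin.<? b)) ≡ + toℕ b
  step Fin.zero    = trans (+-identityˡ _) (∑-χ-none (λ (a : Fin n) → Fin.suc a Fin.<? Fin.zero {n = n}) (allFin n) (λ _ ()))
  step (Fin.suc b) = cong (_+_ (+ 1)) (count-below b)

∑-permute : ∀ (w : Perm m) → IsPerm w → (f : Fin (suc m) → ℤ) → ∑[ i ← allFin (suc m) ] f (w ! i) ≡ ∑ (allFin (suc m)) f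
∑-permute w w-perm = ∑-reindex _≟F_ (Unique.allFin⁺ _) (Unique.allFin⁺ _) (w !_) (λ _ → ∈-allFin _)
                                (λ {a} _ → inverse w w-perm a , ∈-allFin _ , !-inverse w w-perm a) (λ _ _ → w-perm _ _)

rank : ∀ (w : Perm m) → IsPerm w → ∀ j → ∑[ i ← allFin (suc m) ] χ (w ! i Fin.<? w ! j) ≡ + toℕ (w ! j)
rank w w-perm j = trans (∑-permute w w-perm (λ a → χ (a Fin.<? w ! j))) (count-below (w ! j))

order-determines : ∀ (v w : Perm m) → IsPerm v → IsPerm w → (∀ i j → v ! i < v ! j → w ! i < w ! j) → v ≡ w
order-determines {m} v w v-perm w-perm same = Perm-ext λ j → toℕ-injective (+-injective (begin
  + toℕ (v ! j)
    ≡⟨ sym (rank v v-perm j) ⟩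
  ∑[ i ← allFin (suc m) ] χ (v ! i Fin.<? v ! j)
    ≡⟨ ∑-ext (allFin (suc m)) (λ i → χ-⇔ (v ! i Fin.<? v ! j) (w ! i Fin.<? w ! j) (mk⇔ (same i j) (reflect i j))) ⟩
  ∑[ i ← allFin (suc m) ] χ (w ! i Fin.<? w ! j)
    ≡⟨ rank w w-perm j ⟩
  + toℕ (w ! j) ∎))
  where
  open ≡-Reasoning
  reflect : ∀ i j → w ! i < w ! j → v ! i < v ! j
  reflect i j wi<wj with <-cmp (v ! i) (v ! j)
  ... | tri< vi<vj _ _ = vi<vj
  ... | tri≈ _ vi≡vj _ = contradiction (subst (λ k → w ! k < w ! j) (v-perm _ _ vi≡vj) wi<wj) (ℕₚ.<-irrefl refl)
  ... | tri> _ _ vj<vi = contradiction (same j i vj<vi) (ℕₚ.<-asym wi<wj)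

-- Parabolic factorisation

module _ {i j : Fin n} where

  transpose-matchˡ : transpose i j i ≡ j
  transpose-matchˡ rewrite dec-true (i ≟F i) refl = refl

  transpose-matchʳ : i ≢ j → transpose i j j ≡ i
  transpose-matchʳ i≢j rewrite dec-false (j ≟F i) (i≢j ∘ sym) | dec-true (j ≟F j) refl = refl

  transpose-other : ∀ {k} → k ≢ i → k ≢ j → transpose i j k ≡ k
  transpose-other {k} k≢i k≢j rewrite dec-false (k ≟F i) k≢i | dec-false (k ≟F j) k≢j = refl

  transpose-involutive : i ≢ j → ∀ k → transpose i j (transpose i j k) ≡ k
  transpose-involutive i≢j k = by-cases (k ≟F i) (k ≟F j)
    where
    by-cases : Dec (k ≡ i) → Dec (k ≡ j) → transpose i j (transpose i j k) ≡ k
    by-cases (yes refl) _          = trans (cong (transpose i j) transpose-matchˡ) (transpose-matchʳ i≢j)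
    by-cases (no _)     (yes refl) = trans (cong (transpose i j) (transpose-matchʳ i≢j)) transpose-matchˡ
    by-cases (no k≢i)   (no k≢j)   = trans (cong (transpose i j) (transpose-other k≢i k≢j)) (transpose-other k≢i k≢j)

module _ (c : Fin m) where

  private
    τ : Fin (suc m) → Fin (suc m)
    τ = transpose (inject₁ c) (Fin.suc c)

    τ-involutive : ∀ j → τ (τ j) ≡ j
    τ-involutive = transpose-involutive (inject₁≢suc c)

    τ-c : τ (inject₁ c) ≡ Fin.suc c
    τ-c = transpose-matchˡ {i = inject₁ c}

    τ-c+1 : τ (Fin.suc c) ≡ inject₁ c
    τ-c+1 = transpose-matchʳ (inject₁≢suc c)

  swapAt : Perm m → Perm m
  swapAt y = tabulate (λ j → y ! τ j)

  !-swapAt : ∀ y j → swapAt y ! j ≡ y ! τ j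
  !-swapAt y = lookup∘tabulate (λ j → y ! τ j)

  swapAt-at-c : ∀ y → swapAt y ! inject₁ c ≡ y ! Fin.suc c
  swapAt-at-c y = trans (!-swapAt y (inject₁ c)) (cong (y !_) τ-c)

  swapAt-at-c+1 : ∀ y → swapAt y ! Fin.suc c ≡ y ! inject₁ c
  swapAt-at-c+1 y = trans (!-swapAt y (Fin.suc c)) (cong (y !_) τ-c+1)

  swapAt-elsewhere : ∀ y {j} → j ≢ inject₁ c → j ≢ Fin.suc c → swapAt y ! j ≡ y ! j
  swapAt-elsewhere y {j} j≢c j≢c+1 = trans (!-swapAt y j) (cong (y !_) (transpose-other j≢c j≢c+1))

  swapAt-perm : ∀ y → IsPerm y → IsPerm (swapAt y)
  swapAt-perm y y-perm j j′ eq =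
    trans (sym (τ-involutive j))
          (trans (cong τ (y-perm _ _ (trans (sym (!-swapAt y j)) (trans eq (!-swapAt y j′))))) (τ-involutive j′))

  swapAt-involutive : ∀ y → swapAt (swapAt y) ≡ y
  swapAt-involutive y =
    Perm-ext λ j → trans (!-swapAt (swapAt y) j) (trans (!-swapAt y (τ j)) (cong (y !_) (τ-involutive j)))

  ∘ₚ-swapAt : ∀ u v → u ∘ₚ swapAt v ≡ swapAt (u ∘ₚ v)
  ∘ₚ-swapAt u v = Perm-ext λ j → begin
    (u ∘ₚ swapAt v) ! j    ≡⟨ !-∘ₚ u (swapAt v) j ⟩
    u ! (swapAt v ! j)     ≡⟨ cong (u !_) (!-swapAt v j) ⟩
    u ! (v ! τ j)          ≡⟨ sym (!-∘ₚ u v (τ j)) ⟩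
    (u ∘ₚ v) ! τ j         ≡⟨ sym (!-swapAt (u ∘ₚ v) j) ⟩
    swapAt (u ∘ₚ v) ! j    ∎
    where open ≡-Reasoning

  swapAt-cut : ∀ y {c′} → c′ ≢ c → IsCut y c′ → IsCut (swapAt y) c′
  swapAt-cut y {c′} c′≢c cut j k j≤c′ c′<k =
    subst₂ _<_ (sym (!-swapAt y j)) (sym (!-swapAt y k)) (cut (τ j) (τ k) (τ-≤ j≤c′) (τ-> c′<k))
    where
    c≢c′ : toℕ c ≢ toℕ c′
    c≢c′ eq = c′≢c (sym (toℕ-injective eq))
    τ-≤ : ∀ {j} → j ≤ c′ → τ j ≤ c′
    τ-≤ {j} = by-cases (j ≟F inject₁ c) (j ≟F Fin.suc c)
      where
      by-cases : Dec (j ≡ inject₁ c) → Dec (j ≡ Fin.suc c) → j ≤ c′ → τ j ≤ c′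
      by-cases (yes refl) _ j≤c′ = subst (_≤ c′) (sym τ-c)
        (ℕₚ.≤∧≢⇒< (subst (ℕ._≤ toℕ c′) (toℕ-inject₁ c) j≤c′) c≢c′)
      by-cases (no _) (yes refl) j≤c′ = subst (_≤ c′) (sym τ-c+1)
        (subst (ℕ._≤ toℕ c′) (sym (toℕ-inject₁ c)) (ℕₚ.<⇒≤ j≤c′))
      by-cases (no j≢c) (no j≢c+1) j≤c′ = subst (_≤ c′) (sym (transpose-other j≢c j≢c+1)) j≤c′
    τ-> : ∀ {k} → c′ < k → c′ < τ k
    τ-> {k} = by-cases (k ≟F inject₁ c) (k ≟F Fin.suc c)
      where
      by-cases : Dec (k ≡ inject₁ c) → Dec (k ≡ Fin.suc c) → c′ < k → c′ < τ k
      by-cases (yes refl) _ c′<k = subst (c′ <_) (sym τ-c)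
        (ℕₚ.m≤n⇒m≤1+n (subst (toℕ c′ ℕ.<_) (toℕ-inject₁ c) c′<k))
      by-cases (no _) (yes refl) c′<k = subst (c′ <_) (sym τ-c+1)
        (subst (toℕ c′ ℕ.<_) (sym (toℕ-inject₁ c)) (ℕₚ.≤∧≢⇒< (ℕₚ.≤-pred c′<k) (c≢c′ ∘ sym)))
      by-cases (no k≢c) (no k≢c+1) c′<k = subst (c′ <_) (sym (transpose-other k≢c k≢c+1)) c′<k

weight : Perm m → ℕ
weight y = sum (map (λ j → toℕ j ℕ.* toℕ (y ! j)) (allFin _))

weight-swapAt : ∀ (y : Perm m) c → y ! inject₁ c < y ! Fin.suc c → weight (swapAt c y) ℕ.< weight y
weight-swapAt {m} y c ascent with weight y ℕ.≤? weight (swapAt c y)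
... | no  W≰W′ = ℕₚ.≰⇒> W≰W′
... | yes W≤W′ = contradiction balance (ℕₚ.<⇒≢ (ℕₚ.+-mono-≤-< W≤W′ local-decrease) ∘ sym)
  where
  g g′ : Fin (suc m) → ℕ
  g  j = toℕ j ℕ.* toℕ (y ! j)
  g′ j = toℕ j ℕ.* toℕ (swapAt c y ! j)
  x z : ℕ
  x = toℕ (y ! inject₁ c)
  z = toℕ (y ! Fin.suc c)
  g′-outside : ∀ j → j ≢ inject₁ c → j ≢ Fin.suc c → + g′ j ≡ + g j
  g′-outside j j≢c j≢c+1 = cong (λ k → + (toℕ j ℕ.* toℕ k)) (swapAt-elsewhere c y j≢c j≢c+1)
  balance : weight (swapAt c y) ℕ.+ (g (inject₁ c) ℕ.+ g (Fin.suc c)) ≡ weight y ℕ.+ (g′ (inject₁ c) ℕ.+ g′ (Fin.suc c))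
  balance = +-injective (begin
    + (weight (swapAt c y) ℕ.+ (g (inject₁ c) ℕ.+ g (Fin.suc c)))
      ≡⟨ cong (_+ (+ g (inject₁ c) + + g (Fin.suc c))) (+-sum (allFin (suc m)) g′) ⟩
    (∑[ j ← allFin (suc m) ] + g′ j) + (+ g (inject₁ c) + + g (Fin.suc c))
      ≡⟨ ∑-two-point _≟F_ (Unique.allFin⁺ _) (∈-allFin _) (∈-allFin _) (inject₁≢suc c)
                     (λ j → + g′ j) (λ j → + g j) g′-outside ⟩
    (∑[ j ← allFin (suc m) ] + g j) + (+ g′ (inject₁ c) + + g′ (Fin.suc c))
      ≡⟨ cong (_+ (+ g′ (inject₁ c) + + g′ (Fin.suc c))) (sym (+-sum (allFin (suc m)) g)) ⟩
    + (weight y ℕ.+ (g′ (inject₁ c) ℕ.+ g′ (Fin.suc c))) ∎)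
    where open ≡-Reasoning
  local-decrease : g′ (inject₁ c) ℕ.+ g′ (Fin.suc c) ℕ.< g (inject₁ c) ℕ.+ g (Fin.suc c)
  local-decrease = begin-strict
    g′ (inject₁ c) ℕ.+ g′ (Fin.suc c)
      ≡⟨ cong₂ ℕ._+_ (cong₂ ℕ._*_ (toℕ-inject₁ c) (cong toℕ (swapAt-at-c c y)))
                     (cong (toℕ (Fin.suc c) ℕ.*_) (cong toℕ (swapAt-at-c+1 c y))) ⟩
    toℕ c ℕ.* z ℕ.+ suc (toℕ c) ℕ.* x
      ≡⟨ shuffle (toℕ c) x z ⟩
    (toℕ c ℕ.* x ℕ.+ toℕ c ℕ.* z) ℕ.+ x
      <⟨ ℕₚ.+-monoʳ-< (toℕ c ℕ.* x ℕ.+ toℕ c ℕ.* z) ascent ⟩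
    (toℕ c ℕ.* x ℕ.+ toℕ c ℕ.* z) ℕ.+ z
      ≡⟨ shuffle′ (toℕ c) x z ⟩
    toℕ c ℕ.* x ℕ.+ suc (toℕ c) ℕ.* z
      ≡⟨ cong (ℕ._+ suc (toℕ c) ℕ.* z) (cong (ℕ._* x) (sym (toℕ-inject₁ c))) ⟩
    g (inject₁ c) ℕ.+ g (Fin.suc c) ∎
    where
    open ℕₚ.≤-Reasoning
    shuffle : ∀ c x z → c ℕ.* z ℕ.+ suc c ℕ.* x ≡ (c ℕ.* x ℕ.+ c ℕ.* z) ℕ.+ x
    shuffle = ℕ-Solver.solve-∀
    shuffle′ : ∀ c x z → (c ℕ.* x ℕ.+ c ℕ.* z) ℕ.+ z ≡ c ℕ.* x ℕ.+ suc c ℕ.* z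
    shuffle′ = ℕ-Solver.solve-∀

idₚ-cut : ∀ (c : Fin m) → IsCut idₚ c
idₚ-cut c j k j≤c c<k = subst₂ _<_ (sym (!-idₚ j)) (sym (!-idₚ k)) (ℕₚ.≤-<-trans j≤c c<k)

idₚ-cuts : ∀ {T : Subset m} → ∁ T ⊆ C idₚ
idₚ-cuts {x = c} _ = IsCut⇒∈C idₚ (idₚ-cut c)

swapAt-cuts : ∀ {S : Subset m} c (y : Perm m) → c ∈ S → ∁ S ⊆ C y → ∁ S ⊆ C (swapAt c y)
swapAt-cuts {S = S} c y c∈S cuts {c′} c′∈∁S =
  IsCut⇒∈C (swapAt c y) (swapAt-cut c y c′≢c (cut-outside y cuts (x∈∁p⇒x∉p c′∈∁S)))
  where
  c′≢c : c′ ≢ c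
  c′≢c refl = x∈∁p⇒x∉p c′∈∁S c∈S

-- The parabolic factorisation x = u v with v ∈ 𝔖_T and u the longest element of its coset u 𝔖_T.
record Factorisation (S T : Subset m) (x : Perm m) : Set where
  field
    u v        : Perm m
    u-perm     : IsPerm u
    v-perm     : IsPerm v
    u-cuts     : ∁ S ⊆ C u
    u-descents : T ⊆ D u
    v-cuts     : ∁ T ⊆ C v
    factors    : u ∘ₚ v ≡ x

-- Bubble sort: swap an ascent at a gap of T, which lowers the weight, until T ⊆ D(u).
factorise : ∀ {S T : Subset m} → T ⊆ S → ∀ x → IsPerm x → ∁ S ⊆ C x → Factorisation S T x
factorise {m} {S} {T} T⊆S x x-perm x-cuts = go x x-perm x-cuts (<-wellFounded (weight x))
  where
  go : ∀ y → IsPerm y → ∁ S ⊆ C y → Acc ℕ._<_ (weight y) → Factorisation S T y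
  go y y-perm y-cuts (acc smaller) with T ⊆? D y
  ... | yes T⊆Dy = record
    { u = y ; v = idₚ ; u-perm = y-perm ; v-perm = idₚ-perm
    ; u-cuts = y-cuts ; u-descents = T⊆Dy ; v-cuts = idₚ-cuts ; factors = ∘ₚ-idₚ y }
  ... | no T⊈Dy with ¬∀⟶∃¬ m _ (λ c → c ∈? T →-dec c ∈? D y) (λ all → T⊈Dy (all _))
  ...   | c , ¬[c∈T⇒c∈Dy] = record
    { u = F.u ; v = swapAt c F.v ; u-perm = F.u-perm ; v-perm = swapAt-perm c F.v F.v-perm
    ; u-cuts = F.u-cuts ; u-descents = F.u-descents ; v-cuts = swapAt-cuts c F.v c∈T F.v-cuts
    ; factors = trans (∘ₚ-swapAt c F.u F.v) (trans (cong (swapAt c) F.factors) (swapAt-involutive c y)) }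
    where
    c∈T : c ∈ T
    c∈T with c ∈? T
    ... | yes c∈T = c∈T
    ... | no  c∉T = contradiction (λ c∈T → contradiction c∈T c∉T) ¬[c∈T⇒c∈Dy]
    ascent : y ! inject₁ c < y ! Fin.suc c
    ascent = ¬descent⇒ascent y y-perm (λ descent → ¬[c∈T⇒c∈Dy] (λ _ → IsDescent⇒∈D y descent))
    F : Factorisation S T (swapAt c y)
    F = go (swapAt c y) (swapAt-perm c y y-perm) (swapAt-cuts c y (T⊆S c∈T) y-cuts)
           (smaller (weight-swapAt y c ascent))
    module F = Factorisation F

∘ₚ-cut : ∀ (u v : Perm m) → IsPerm v → ∀ {c} → IsCut u c → IsCut v c → IsCut (u ∘ₚ v) c
∘ₚ-cut u v v-perm {c} u-cut v-cut j k j≤c c<k =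
  subst₂ _<_ (sym (!-∘ₚ u v j)) (sym (!-∘ₚ u v k)) (u-cut _ _ (cut-≤ v v-perm c v-cut j≤c) (cut-> v v-perm c v-cut c<k))

∘ₚ-cuts : ∀ {S T : Subset m} → T ⊆ S → ∀ u v → IsPerm v → ∁ S ⊆ C u → ∁ T ⊆ C v → ∁ S ⊆ C (u ∘ₚ v)
∘ₚ-cuts {S = S} {T} T⊆S u v v-perm u-cuts v-cuts {c} c∈∁S =
  IsCut⇒∈C (u ∘ₚ v) (∘ₚ-cut u v v-perm (cut-outside u u-cuts c∉S) (cut-outside v v-cuts (c∉S ∘ T⊆S)))
  where
  c∉S : c ∉ S
  c∉S = x∈∁p⇒x∉p c∈∁S

module _ {T : Subset m} (u v : Perm m) (v-perm : IsPerm v) (u-descents : T ⊆ D u) (v-cuts : ∁ T ⊆ C v) where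

  ∘ₚ-reverses-block : ∀ {a b} → SameBlock T a b → v ! a < v ! b → (u ∘ₚ v) ! b < (u ∘ₚ v) ! a
  ∘ₚ-reverses-block {a} {b} a~b va<vb = subst₂ _<_ (sym (!-∘ₚ u v b)) (sym (!-∘ₚ u v a))
    (descending-block u u-descents va<vb (block-image v v-perm v-cuts a~b))

  ∘ₚ-ascents : ∀ {U : Subset m} → U ⊆ T → U ⊆ D v → U ⊆ ∁ (D (u ∘ₚ v))
  ∘ₚ-ascents U⊆T U⊆Dv {c} c∈U = x∉p⇒x∈∁p λ c∈Dx →
    ℕₚ.<-asym (∈D⇒IsDescent (u ∘ₚ v) c∈Dx)
              (∘ₚ-reverses-block (block-sym (gap-block (U⊆T c∈U))) (descent-at v U⊆Dv c∈U))

module _ {S T : Subset m} {x : Perm m} (F : Factorisation S T x) where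

  open Factorisation F

  factors-at : ∀ j → x ! j ≡ u ! (v ! j)
  factors-at j = trans (cong (_! j) (sym factors)) (!-∘ₚ u v j)

  factorisation-reverses-block : ∀ {a b} → SameBlock T a b → v ! a < v ! b → x ! b < x ! a
  factorisation-reverses-block a~b va<vb =
    subst (λ y → y ! _ < y ! _) factors (∘ₚ-reverses-block u v v-perm u-descents v-cuts a~b va<vb)

  ascents-descend : ∀ {U : Subset m} → U ⊆ T → U ⊆ ∁ (D x) → U ⊆ D v
  ascents-descend U⊆T U⊆Ax {c} c∈U with c ∈? D v
  ... | yes c∈Dv = c∈Dv
  ... | no  c∉Dv = contradiction (IsDescent⇒∈D x x-descent) (x∈∁p⇒x∉p (U⊆Ax c∈U))
    where
    x-descent : IsDescent x c
    x-descent = subst₂ _<_ (sym (factors-at (Fin.suc c))) (sym (factors-at (inject₁ c)))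
      (descending-block u u-descents (¬descent⇒ascent v v-perm (c∉Dv ∘ IsDescent⇒∈D v))
                        (block-image v v-perm v-cuts (gap-block (U⊆T c∈U))))

module _ {S T : Subset m} {x : Perm m} (F G : Factorisation S T x) where

  private
    module F = Factorisation F
    module G = Factorisation G

  same-order-in-block : ∀ {a b} → SameBlock T a b → F.v ! a < F.v ! b → G.v ! a < G.v ! b
  same-order-in-block {a} {b} a~b Fa<Fb with <-cmp (G.v ! a) (G.v ! b)
  ... | tri< Ga<Gb _ _ = Ga<Gb
  ... | tri≈ _ Ga≡Gb _ = contradiction Fa<Fb (ℕₚ.<-irrefl (cong (λ i → toℕ (F.v ! i)) (G.v-perm _ _ Ga≡Gb)))
  ... | tri> _ _ Gb<Ga = contradiction (factorisation-reverses-block G (block-sym a~b) Gb<Ga)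
                                       (ℕₚ.<-asym (factorisation-reverses-block F a~b Fa<Fb))

  same-order : ∀ j k → F.v ! j < F.v ! k → G.v ! j < G.v ! k
  same-order j k Fj<Fk with <-cmp j k
  ... | tri≈ _ refl _ = contradiction Fj<Fk (ℕₚ.<-irrefl refl)
  ... | tri< j<k _ _ with separated-or-block j<k
  ...   | inj₁ j|k = separated-< G.v G.v-cuts j|k
  ...   | inj₂ j~k = same-order-in-block j~k Fj<Fk
  same-order j k Fj<Fk | tri> _ _ k<j with separated-or-block k<j
  ...   | inj₁ k|j = contradiction (separated-< F.v F.v-cuts k|j) (ℕₚ.<-asym Fj<Fk)
  ...   | inj₂ k~j = same-order-in-block (block-sym k~j) Fj<Fk

  factorisation-unique : F.u ≡ G.u × F.v ≡ G.v
  factorisation-unique = u-eq , v-eq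
    where
    v-eq : F.v ≡ G.v
    v-eq = order-determines F.v G.v F.v-perm G.v-perm same-order
    u-eq : F.u ≡ G.u
    u-eq = Perm-ext λ a → begin
      F.u ! a                  ≡⟨ cong (F.u !_) (sym (!-inverse F.v F.v-perm a)) ⟩
      F.u ! (F.v ! v⁻¹ a)    ≡⟨ sym (factors-at F _) ⟩
      x ! v⁻¹ a              ≡⟨ factors-at G _ ⟩
      G.u ! (G.v ! v⁻¹ a)    ≡⟨ cong (λ w → G.u ! (w ! v⁻¹ a)) (sym v-eq) ⟩
      G.u ! (F.v ! v⁻¹ a)    ≡⟨ cong (G.u !_) (!-inverse F.v F.v-perm a) ⟩
      G.u ! a                  ∎
      where
      open ≡-Reasoning
      v⁻¹ : Fin (suc m) → Fin (suc m)
      v⁻¹ = inverse F.v F.v-perm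

module _ {m : ℕ} where

  private
    Pos : Set
    Pos = Fin (suc m)
    positions : List Pos
    positions = allFin (suc m)
    pairs : List (Pos × Pos)
    pairs = cartesianProduct positions positions

  ⟦_<_⟧ : Pos → Pos → ℤ
  ⟦ a < b ⟧ = χ (a Fin.<? b)

  inv-∑ : ∀ (w : Perm m) → + inv w ≡ ∑ pairs (λ (i , j) → ⟦ i < j ⟧ * ⟦ w ! j < w ! i ⟧)
  inv-∑ w = trans (length-filter (λ (i , j) → (i Fin.<? j) ×-dec (w ! j Fin.<? w ! i)) pairs)
                  (∑-ext pairs (λ (i , j) → χ-× (i Fin.<? j) (w ! j Fin.<? w ! i)))

  ∑-pairs-swap : ∀ (h : Pos × Pos → ℤ) → ∑ pairs (λ (i , j) → h (j , i)) ≡ ∑ pairs h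
  ∑-pairs-swap h = begin
    ∑ pairs (λ (i , j) → h (j , i))
      ≡⟨ ∑-cartesianProduct positions positions (λ (i , j) → h (j , i)) ⟩
    ∑[ i ← positions ] ∑[ j ← positions ] h (j , i)
      ≡⟨ ∑-comm positions positions (λ i j → h (j , i)) ⟩
    ∑[ j ← positions ] ∑[ i ← positions ] h (j , i)
      ≡⟨ sym (∑-cartesianProduct positions positions h) ⟩
    ∑ pairs h ∎
    where open ≡-Reasoning

  ∑-pairs-permute : ∀ (v : Perm m) → IsPerm v → (h : Pos × Pos → ℤ) → ∑ pairs (λ (i , j) → h (v ! i , v ! j)) ≡ ∑ pairs h
  ∑-pairs-permute v v-perm h = begin
    ∑ pairs (λ (i , j) → h (v ! i , v ! j))
      ≡⟨ ∑-cartesianProduct positions positions (λ (i , j) → h (v ! i , v ! j)) ⟩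
    ∑[ i ← positions ] ∑[ j ← positions ] h (v ! i , v ! j)
      ≡⟨ ∑-ext positions (λ i → ∑-permute v v-perm (λ b → h (v ! i , b))) ⟩
    ∑[ i ← positions ] ∑[ b ← positions ] h (v ! i , b)
      ≡⟨ ∑-permute v v-perm (λ a → ∑[ b ← positions ] h (a , b)) ⟩
    ∑[ a ← positions ] ∑[ b ← positions ] h (a , b)
      ≡⟨ sym (∑-cartesianProduct positions positions h) ⟩
    ∑ pairs h ∎
    where open ≡-Reasoning

  ∑-pairs-symmetrise : ∀ (h : Pos × Pos → ℤ) → (∀ i → h (i , i) ≡ + 0) →
                       ∑ pairs h ≡ ∑ pairs (λ (i , j) → ⟦ i < j ⟧ * (h (i , j) + h (j , i)))
  ∑-pairs-symmetrise h h-diagonal = begin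
    ∑ pairs h
      ≡⟨ ∑-ext pairs split ⟩
    ∑ pairs (λ (i , j) → ⟦ i < j ⟧ * h (i , j) + ⟦ j < i ⟧ * h (i , j))
      ≡⟨ ∑-+ pairs (λ (i , j) → ⟦ i < j ⟧ * h (i , j)) (λ (i , j) → ⟦ j < i ⟧ * h (i , j)) ⟩
    ∑ pairs (λ (i , j) → ⟦ i < j ⟧ * h (i , j)) + ∑ pairs (λ (i , j) → ⟦ j < i ⟧ * h (i , j))
      ≡⟨ cong (_+_ (∑ pairs (λ (i , j) → ⟦ i < j ⟧ * h (i , j))))
              (sym (∑-pairs-swap (λ (i , j) → ⟦ j < i ⟧ * h (i , j)))) ⟩
    ∑ pairs (λ (i , j) → ⟦ i < j ⟧ * h (i , j)) + ∑ pairs (λ (i , j) → ⟦ i < j ⟧ * h (j , i))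
      ≡⟨ sym (∑-+ pairs (λ (i , j) → ⟦ i < j ⟧ * h (i , j)) (λ (i , j) → ⟦ i < j ⟧ * h (j , i))) ⟩
    ∑ pairs (λ (i , j) → ⟦ i < j ⟧ * h (i , j) + ⟦ i < j ⟧ * h (j , i))
      ≡⟨ ∑-ext pairs (λ (i , j) → sym (*-distribˡ-+ ⟦ i < j ⟧ (h (i , j)) (h (j , i)))) ⟩
    ∑ pairs (λ (i , j) → ⟦ i < j ⟧ * (h (i , j) + h (j , i))) ∎
    where
    open ≡-Reasoning
    split : ∀ ((i , j) : Pos × Pos) → h (i , j) ≡ ⟦ i < j ⟧ * h (i , j) + ⟦ j < i ⟧ * h (i , j)
    split (i , j) with <-cmp i j
    ... | tri< i<j _ j≮i rewrite χ-yes (i Fin.<? j) i<j | χ-no (j Fin.<? i) j≮i =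
      sym (trans (+-identityʳ _) (*-identityˡ _))
    ... | tri> i≮j _ j<i rewrite χ-no (i Fin.<? j) i≮j | χ-yes (j Fin.<? i) j<i =
      sym (trans (+-identityˡ _) (*-identityˡ _))
    ... | tri≈ _ refl _ rewrite h-diagonal i = sym (cong₂ _+_ (*-zeroʳ ⟦ i < i ⟧) (*-zeroʳ ⟦ i < i ⟧))

  ⟦<⟧-yes : ∀ {a b : Pos} → a < b → ⟦ a < b ⟧ ≡ + 1
  ⟦<⟧-yes {a} {b} = χ-yes (a Fin.<? b)

  ⟦<⟧-no : ∀ {a b : Pos} → ¬ a < b → ⟦ a < b ⟧ ≡ + 0
  ⟦<⟧-no {a} {b} = χ-no (a Fin.<? b)

  module _ {T : Subset m} (u v : Perm m) (v-perm : IsPerm v) (u-descents : T ⊆ D u) (v-cuts : ∁ T ⊆ C v) where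

    private
      x : Perm m
      x = u ∘ₚ v

      reverses : ∀ {a b} → SameBlock T a b → v ! a < v ! b → x ! b < x ! a
      reverses = ∘ₚ-reverses-block u v v-perm u-descents v-cuts

    -- Within a T-block u reverses the order of v, so such a pair is inverted by exactly one of x and v.
    inversion-pair : ∀ {i j} → i < j →
                     ⟦ x ! j < x ! i ⟧ + ⟦ v ! j < v ! i ⟧ ≡
                     ⟦ v ! i < v ! j ⟧ * ⟦ x ! j < x ! i ⟧ + ⟦ v ! j < v ! i ⟧ * ⟦ x ! i < x ! j ⟧
    inversion-pair {i} {j} i<j with separated-or-block i<j
    ... | inj₁ i|j rewrite ⟦<⟧-yes (separated-< v v-cuts i|j) | ⟦<⟧-no (ℕₚ.<-asym (separated-< v v-cuts i|j)) =
      lemma ⟦ x ! j < x ! i ⟧ ⟦ x ! i < x ! j ⟧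
      where
      lemma : ∀ X Y → X + + 0 ≡ + 1 * X + + 0 * Y
      lemma = solve-∀
    ... | inj₂ i~j with <-cmp (v ! i) (v ! j)
    ...   | tri≈ _ vi≡vj _ = contradiction (cong toℕ (v-perm _ _ vi≡vj)) (ℕₚ.<⇒≢ i<j)
    ...   | tri< vi<vj _ vj≮vi rewrite ⟦<⟧-yes vi<vj | ⟦<⟧-no vj≮vi | ⟦<⟧-yes (reverses i~j vi<vj) = refl
    ...   | tri> vi≮vj _ vj<vi rewrite ⟦<⟧-no vi≮vj | ⟦<⟧-yes vj<vi | ⟦<⟧-yes (reverses (block-sym i~j) vj<vi)
                                     | ⟦<⟧-no (ℕₚ.<-asym (reverses (block-sym i~j) vj<vi)) = refl

    inv-∘ₚ : inv x ℕ.+ inv v ≡ inv u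
    inv-∘ₚ = +-injective (begin
      + inv x + + inv v
        ≡⟨ cong₂ _+_ (inv-∑ x) (inv-∑ v) ⟩
      ∑ pairs (λ (i , j) → ⟦ i < j ⟧ * ⟦ x ! j < x ! i ⟧) + ∑ pairs (λ (i , j) → ⟦ i < j ⟧ * ⟦ v ! j < v ! i ⟧)
        ≡⟨ sym (∑-+ pairs (λ (i , j) → ⟦ i < j ⟧ * ⟦ x ! j < x ! i ⟧) (λ (i , j) → ⟦ i < j ⟧ * ⟦ v ! j < v ! i ⟧)) ⟩
      ∑ pairs (λ (i , j) → ⟦ i < j ⟧ * ⟦ x ! j < x ! i ⟧ + ⟦ i < j ⟧ * ⟦ v ! j < v ! i ⟧)
        ≡⟨ ∑-ext pairs (λ (i , j) → sym (*-distribˡ-+ ⟦ i < j ⟧ ⟦ x ! j < x ! i ⟧ ⟦ v ! j < v ! i ⟧)) ⟩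
      ∑ pairs (λ (i , j) → ⟦ i < j ⟧ * (⟦ x ! j < x ! i ⟧ + ⟦ v ! j < v ! i ⟧))
        ≡⟨ ∑-ext pairs pairwise ⟩
      ∑ pairs (λ (i , j) → ⟦ i < j ⟧ * (H (i , j) + H (j , i)))
        ≡⟨ sym (∑-pairs-symmetrise H (λ i → cong (_* ⟦ x ! i < x ! i ⟧) (⟦<⟧-no {v ! i} {v ! i} (ℕₚ.<-irrefl refl)))) ⟩
      ∑ pairs H
        ≡⟨ ∑-ext pairs (λ (i , j) → cong₂ (λ a b → ⟦ v ! i < v ! j ⟧ * ⟦ a < b ⟧) (!-∘ₚ u v j) (!-∘ₚ u v i)) ⟩
      ∑ pairs (λ (i , j) → ⟦ v ! i < v ! j ⟧ * ⟦ u ! (v ! j) < u ! (v ! i) ⟧)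
        ≡⟨ ∑-pairs-permute v v-perm (λ (a , b) → ⟦ a < b ⟧ * ⟦ u ! b < u ! a ⟧) ⟩
      ∑ pairs (λ (a , b) → ⟦ a < b ⟧ * ⟦ u ! b < u ! a ⟧)
        ≡⟨ sym (inv-∑ u) ⟩
      + inv u ∎)
      where
      open ≡-Reasoning
      H : Pos × Pos → ℤ
      H (i , j) = ⟦ v ! i < v ! j ⟧ * ⟦ x ! j < x ! i ⟧
      pairwise : ∀ ((i , j) : Pos × Pos) →
                 ⟦ i < j ⟧ * (⟦ x ! j < x ! i ⟧ + ⟦ v ! j < v ! i ⟧) ≡ ⟦ i < j ⟧ * (H (i , j) + H (j , i))
      pairwise (i , j) with i Fin.<? j
      ... | yes i<j rewrite ⟦<⟧-yes i<j = cong (+ 1 *_) (inversion-pair i<j)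
      ... | no  i≮j rewrite ⟦<⟧-no i≮j = refl

no-descent⇒idₚ : ∀ (x : Perm m) → IsPerm x → (∀ c → ¬ IsDescent x c) → x ≡ idₚ
no-descent⇒idₚ x x-perm ascents =
  sym (order-determines idₚ x idₚ-perm x-perm λ i j i<j → no-descent-increasing x x-perm ascents
        (subst₂ _<_ (!-idₚ i) (!-idₚ j) i<j))

inv-idₚ : inv (idₚ {m}) ≡ 0
inv-idₚ {m} = ℕₚ.+-cancelʳ-≡ (inv id) (inv id) 0
  (trans (cong (λ w → inv w ℕ.+ inv id) (sym (∘ₚ-idₚ id))) (inv-∘ₚ {T = ⊥} id id idₚ-perm ⊥⊆ idₚ-cuts))
  where
  id : Perm m
  id = idₚ

-- The inverse of A

module _ {m : ℕ} where

  A? : ∀ S T (w : Perm m) → Dec (∁ S ⊆ C w × T ⊆ D w)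
  A? S T w = (∁ S ⊆? C w) ×-dec (T ⊆? D w)

  A↑? : ∀ S U (w : Perm m) → Dec (∁ S ⊆ C w × U ⊆ ∁ (D w))
  A↑? S U w = (∁ S ⊆? C w) ×-dec (U ⊆? ∁ (D w))

  A↑ : Mat m
  A↑ S U = invSum (A↑? S U)

  cut-descent-perms : Subset m → Subset m → List (Perm m)
  cut-descent-perms S T = filter (A? S T) (Sym (suc m))

  cut-ascent-perms : Subset m → Subset m → List (Perm m)
  cut-ascent-perms S U = filter (A↑? S U) (Sym (suc m))

  module _ {S T : Subset m} where

    ∈-cut-descent-perms⁻ : ∀ {w} → w ∈ₗ cut-descent-perms S T → IsPerm w × ∁ S ⊆ C w × T ⊆ D w
    ∈-cut-descent-perms⁻ w∈ with ∈-filter⁻ (A? S T) {xs = Sym (suc m)} w∈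
    ... | w∈Sym , cuts , descents = ∈-Sym⁻ w∈Sym , cuts , descents

    ∈-cut-descent-perms⁺ : ∀ {w} → IsPerm w → ∁ S ⊆ C w → T ⊆ D w → w ∈ₗ cut-descent-perms S T
    ∈-cut-descent-perms⁺ w-perm cuts descents =
      ∈-filter⁺ (A? S T) (∈-Sym⁺ w-perm) (cuts , descents)

    ∈-cut-ascent-perms⁻ : ∀ {w} → w ∈ₗ cut-ascent-perms S T → IsPerm w × ∁ S ⊆ C w × T ⊆ ∁ (D w)
    ∈-cut-ascent-perms⁻ w∈ with ∈-filter⁻ (A↑? S T) {xs = Sym (suc m)} w∈
    ... | w∈Sym , cuts , ascents = ∈-Sym⁻ w∈Sym , cuts , ascents

    ∈-cut-ascent-perms⁺ : ∀ {w} → IsPerm w → ∁ S ⊆ C w → T ⊆ ∁ (D w) → w ∈ₗ cut-ascent-perms S T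
    ∈-cut-ascent-perms⁺ w-perm cuts ascents =
      ∈-filter⁺ (A↑? S T) (∈-Sym⁺ w-perm) (cuts , ascents)

    cut-descent-perms-unique : Unique (cut-descent-perms S T)
    cut-descent-perms-unique = Unique.filter⁺ _ (Sym-unique (suc m))

    cut-ascent-perms-unique : Unique (cut-ascent-perms S T)
    cut-ascent-perms-unique = Unique.filter⁺ _ (Sym-unique (suc m))

  descents⊆noncuts : ∀ {S T} (w : Perm m) → ∁ S ⊆ C w → T ⊆ D w → T ⊆ S
  descents⊆noncuts {S} w cuts descents {c} c∈T with c ∈? S
  ... | yes c∈S = c∈S
  ... | no  c∉S = contradiction (descent-at w descents c∈T) (cut⇒¬descent w c (cut-outside w cuts c∉S))

  cut-descent-perms⇒⊆ : ∀ {S T w} → w ∈ₗ cut-descent-perms S T → T ⊆ S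
  cut-descent-perms⇒⊆ {w = w} w∈ = let _ , cuts , descents = ∈-cut-descent-perms⁻ w∈ in descents⊆noncuts w cuts descents

  ∑-factorisations : ∀ {S T U : Subset m} → U ⊆ T → T ⊆ S → (h : Perm m → ℤ) →
                     ∑[ u ← cut-descent-perms S T ] ∑[ v ← cut-descent-perms T U ] h (u ∘ₚ v) ≡ ∑ (cut-ascent-perms S U) h
  ∑-factorisations {S} {T} {U} U⊆T T⊆S h =
    trans (sym (∑-cartesianProduct (cut-descent-perms S T) (cut-descent-perms T U) (λ (u , v) → h (u ∘ₚ v))))
          (∑-reindex (≡-dec _≟F_) (Unique.cartesianProduct⁺ cut-descent-perms-unique cut-descent-perms-unique)
                     cut-ascent-perms-unique (λ (u , v) → u ∘ₚ v) into onto injective h)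
    where
    cart : List (Perm m × Perm m)
    cart = cartesianProduct (cut-descent-perms S T) (cut-descent-perms T U)

    pair-facts : ∀ {u v} → (u , v) ∈ₗ cart → (IsPerm u × ∁ S ⊆ C u × T ⊆ D u) × (IsPerm v × ∁ T ⊆ C v × U ⊆ D v)
    pair-facts p∈ with ∈-cartesianProduct⁻ (cut-descent-perms S T) (cut-descent-perms T U) p∈
    ... | u∈ , v∈ = ∈-cut-descent-perms⁻ u∈ , ∈-cut-descent-perms⁻ v∈

    into : ∀ {p} → p ∈ₗ cart → proj₁ p ∘ₚ proj₂ p ∈ₗ cut-ascent-perms S U
    into {u , v} p∈ =
      let (u-perm , u-cuts , u-descents) , (v-perm , v-cuts , v-descents) = pair-facts p∈
      in ∈-cut-ascent-perms⁺ (∘ₚ-perm u v u-perm v-perm) (∘ₚ-cuts T⊆S u v v-perm u-cuts v-cuts)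
                             (∘ₚ-ascents u v v-perm u-descents v-cuts U⊆T v-descents)

    onto : ∀ {x} → x ∈ₗ cut-ascent-perms S U → ∃ λ p → p ∈ₗ cart × proj₁ p ∘ₚ proj₂ p ≡ x
    onto {x} x∈ = (F.u , F.v) , ∈-cartesianProduct⁺ (∈-cut-descent-perms⁺ F.u-perm F.u-cuts F.u-descents)
                                                    (∈-cut-descent-perms⁺ F.v-perm F.v-cuts (ascents-descend F U⊆T x-ascents)) , F.factors
      where
      x-perm : IsPerm x
      x-perm = proj₁ (∈-cut-ascent-perms⁻ x∈)
      x-cuts : ∁ S ⊆ C x
      x-cuts = proj₁ (proj₂ (∈-cut-ascent-perms⁻ x∈))
      x-ascents : U ⊆ ∁ (D x)
      x-ascents = proj₂ (proj₂ (∈-cut-ascent-perms⁻ x∈))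
      F : Factorisation S T x
      F = factorise T⊆S x x-perm x-cuts
      module F = Factorisation F

    as-factorisation : ∀ {u v x} → (u , v) ∈ₗ cart → u ∘ₚ v ≡ x → Factorisation S T x
    as-factorisation {u} {v} p∈ u∘v≡x =
      let (u-perm , u-cuts , u-descents) , (v-perm , v-cuts , _) = pair-facts p∈
      in record { u = u ; v = v ; u-perm = u-perm ; v-perm = v-perm
                ; u-cuts = u-cuts ; u-descents = u-descents ; v-cuts = v-cuts ; factors = u∘v≡x }

    injective : ∀ {p p′} → p ∈ₗ cart → p′ ∈ₗ cart → proj₁ p ∘ₚ proj₂ p ≡ proj₁ p′ ∘ₚ proj₂ p′ → p ≡ p′
    injective {u , v} {u′ , v′} p∈ p′∈ eq =
      let u≡u′ , v≡v′ = factorisation-unique (as-factorisation p∈ eq) (as-factorisation p′∈ refl)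
      in cong₂ _,_ u≡u′ v≡v′

  inv-quotient : ∀ {T : Subset m} (u v : Perm m) → IsPerm v → T ⊆ D u → ∁ T ⊆ C v → + inv u - + inv v ≡ + inv (u ∘ₚ v)
  inv-quotient u v v-perm u-descents v-cuts = begin
    + inv u - + inv v
      ≡⟨ cong (λ n → + n - + inv v) (sym (inv-∘ₚ u v v-perm u-descents v-cuts)) ⟩
    + inv (u ∘ₚ v) + + inv v - + inv v
      ≡⟨ cancel (+ inv (u ∘ₚ v)) (+ inv v) ⟩
    + inv (u ∘ₚ v) ∎
    where
    open ≡-Reasoning
    cancel : ∀ a b → a + b - b ≡ a
    cancel = solve-∀

  coeff-A*recipA-∑∑ : ∀ S T U k → coeff k (A S T *L recip (A T U)) ≡
                   ∑[ u ← cut-descent-perms S T ] ∑[ v ← cut-descent-perms T U ] χ (+ inv u - + inv v ≟ℤ k)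
  coeff-A*recipA-∑∑ S T U k = begin
    coeff k (A S T *L recip (A T U))
      ≡⟨ cong (λ r → coeff k (A S T *L r)) (recip-ΣL-qpow (cut-descent-perms T U) (λ v → + inv v)) ⟩
    coeff k (A S T *L ΣL (cut-descent-perms T U) (λ v → qpow (- + inv v)))
      ≡⟨ coeff-ΣL-qpow-*L k (cut-descent-perms S T) (cut-descent-perms T U) (λ u → + inv u) (λ v → - + inv v) ⟩
    ∑[ u ← cut-descent-perms S T ] ∑[ v ← cut-descent-perms T U ] χ (+ inv u - + inv v ≟ℤ k) ∎
    where open ≡-Reasoning

  coeff-A*recipA : ∀ S T U k → coeff k (A S T *L recip (A T U)) ≡ χ (U ⊆? T) * χ (T ⊆? S) * coeff k (A↑ S U)
  coeff-A*recipA S T U k with U ⊆? T | T ⊆? S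
  ... | yes U⊆T | yes T⊆S = begin
    coeff k (A S T *L recip (A T U))
      ≡⟨ coeff-A*recipA-∑∑ S T U k ⟩
    ∑[ u ← cut-descent-perms S T ] ∑[ v ← cut-descent-perms T U ] χ (+ inv u - + inv v ≟ℤ k)
      ≡⟨ ∑-cong (cut-descent-perms S T) (λ u∈ → ∑-cong (cut-descent-perms T U) (λ v∈ →
           cong (λ i → χ (i ≟ℤ k)) (quotient u∈ v∈))) ⟩
    ∑[ u ← cut-descent-perms S T ] ∑[ v ← cut-descent-perms T U ] χ (+ inv (u ∘ₚ v) ≟ℤ k)
      ≡⟨ ∑-factorisations U⊆T T⊆S (λ x → χ (+ inv x ≟ℤ k)) ⟩
    ∑[ x ← cut-ascent-perms S U ] χ (+ inv x ≟ℤ k)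
      ≡⟨ sym (coeff-ΣL-qpow k (cut-ascent-perms S U) (λ x → + inv x)) ⟩
    coeff k (A↑ S U)
      ≡⟨ sym (*-identityˡ _) ⟩
    + 1 * + 1 * coeff k (A↑ S U) ∎
    where
    open ≡-Reasoning
    quotient : ∀ {u v} → u ∈ₗ cut-descent-perms S T → v ∈ₗ cut-descent-perms T U → + inv u - + inv v ≡ + inv (u ∘ₚ v)
    quotient {u} {v} u∈ v∈ =
      let _ , _ , u-descents = ∈-cut-descent-perms⁻ u∈
          v-perm , v-cuts , _ = ∈-cut-descent-perms⁻ v∈
      in inv-quotient u v v-perm u-descents v-cuts
  ... | no U⊈T | _ = trans (coeff-A*recipA-∑∑ S T U k) (∑-vanishes (cut-descent-perms S T) inner-zero)
    where
    inner-zero : ∀ u → ∑[ v ← cut-descent-perms T U ] χ (+ inv u - + inv v ≟ℤ k) ≡ + 0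
    inner-zero u = ∑-no-members (cut-descent-perms T U) _ (U⊈T ∘ cut-descent-perms⇒⊆)
  ... | yes _ | no T⊈S =
    trans (coeff-A*recipA-∑∑ S T U k) (∑-no-members (cut-descent-perms S T) _ (T⊈S ∘ cut-descent-perms⇒⊆))

  cut-ascent-perms-diagonal : ∀ {S x} → x ∈ₗ cut-ascent-perms S S → x ≡ idₚ
  cut-ascent-perms-diagonal {S} {x} x∈ = no-descent⇒idₚ x (proj₁ facts) no-descent
    where
    facts : IsPerm x × ∁ S ⊆ C x × S ⊆ ∁ (D x)
    facts = ∈-cut-ascent-perms⁻ x∈
    no-descent : ∀ c → ¬ IsDescent x c
    no-descent c with c ∈? S
    ... | yes c∈S = λ descent → x∈∁p⇒x∉p (proj₂ (proj₂ facts) c∈S) (IsDescent⇒∈D x descent)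
    ... | no  c∉S = cut⇒¬descent x c (cut-outside x (proj₁ (proj₂ facts)) c∉S)

  idₚ∈cut-ascent-perms : ∀ {S} → idₚ ∈ₗ cut-ascent-perms S S
  idₚ∈cut-ascent-perms = ∈-cut-ascent-perms⁺ idₚ-perm idₚ-cuts
    (λ {c} _ → x∉p⇒x∈∁p (λ c∈D → cut⇒¬descent idₚ c (idₚ-cut c) (∈D⇒IsDescent idₚ c∈D)))

  A↑-diagonal : ∀ S k → coeff k (A↑ S S) ≡ χ (+ 0 ≟ℤ k)
  A↑-diagonal S k = begin
    coeff k (A↑ S S)
      ≡⟨ coeff-ΣL-qpow k (cut-ascent-perms S S) (λ x → + inv x) ⟩
    ∑[ x ← cut-ascent-perms S S ] χ (+ inv x ≟ℤ k)
      ≡⟨ ∑-only (≡-dec _≟F_) cut-ascent-perms-unique idₚ∈cut-ascent-perms cut-ascent-perms-diagonal (λ x → χ (+ inv x ≟ℤ k)) ⟩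
    χ (+ inv (idₚ {m}) ≟ℤ k)
      ≡⟨ cong (λ n → χ (+ n ≟ℤ k)) (inv-idₚ {m}) ⟩
    χ (+ 0 ≟ℤ k) ∎
    where open ≡-Reasoning

module _ {m : ℕ} where

  coeff-Id : ∀ (S U : Subset m) k → coeff k (Id S U) ≡ χ (S ≟S U) * χ (+ 0 ≟ℤ k)
  coeff-Id S U k = trans (≋⇒≈M Id≋δ S U k) (coeff-scalar (λ S T → χ (S ≟S T)) S U k)

  collapse-diagonal : ∀ (S U : Subset m) k → χ (U ≟S S) * coeff k (A↑ S U) ≡ χ (S ≟S U) * χ (+ 0 ≟ℤ k)
  collapse-diagonal S U k with U ≟S S | S ≟S U
  ... | yes refl | yes _    = cong (+ 1 *_) (A↑-diagonal S k)
  ... | yes refl | no S≢S   = contradiction refl S≢S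
  ... | no U≢S   | yes refl = contradiction refl U≢S
  ... | no _     | no _     = refl

  ∑-signed-A*recipA : ∀ (σ : Subset m → ℤ) (S U : Subset m) →
                      ∑[ T ← allSubsets m ] σ T * (χ (U ⊆? T) * χ (T ⊆? S)) ≡ χ (U ≟S S) →
                      ∀ k → ∑[ T ← allSubsets m ] σ T * coeff k (A S T *L recip (A T U)) ≡ χ (S ≟S U) * χ (+ 0 ≟ℤ k)
  ∑-signed-A*recipA σ S U alternating k = begin
    ∑[ T ← allSubsets m ] σ T * coeff k (A S T *L recip (A T U))
      ≡⟨ ∑-ext (allSubsets m) (λ T → cong (σ T *_) (coeff-A*recipA S T U k)) ⟩
    ∑[ T ← allSubsets m ] σ T * (χ (U ⊆? T) * χ (T ⊆? S) * e)
      ≡⟨ ∑-ext (allSubsets m) (λ T → sym (*-assoc (σ T) _ e)) ⟩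
    ∑[ T ← allSubsets m ] σ T * (χ (U ⊆? T) * χ (T ⊆? S)) * e
      ≡⟨ ∑-*ʳ (allSubsets m) e (λ T → σ T * (χ (U ⊆? T) * χ (T ⊆? S))) ⟩
    (∑[ T ← allSubsets m ] σ T * (χ (U ⊆? T) * χ (T ⊆? S))) * e
      ≡⟨ cong (_* e) alternating ⟩
    χ (U ≟S S) * e
      ≡⟨ collapse-diagonal S U k ⟩
    χ (S ≟S U) * χ (+ 0 ≟ℤ k) ∎
    where
    open ≡-Reasoning
    e : ℤ
    e = coeff k (A↑ S U)

  A-inverse : IsInverse (A {m}) (signedRecip A)
  A-inverse = right , left
    where
    right : (A ⊗ signedRecip A) ≈M Id
    right S U k = begin
      coeff k ((A ⊗ signedRecip A) S U)
        ≡⟨ coeff-⊗ A (signedRecip A) S U k ⟩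
      ∑[ T ← allSubsets m ] coeff k (A S T *L (σ T U ·L recip (A T U)))
        ≡⟨ ∑-ext (allSubsets m) (λ T → *L-·L (σ T U) (A S T) (recip (A T U)) k) ⟩
      ∑[ T ← allSubsets m ] coeff k (σ T U ·L (A S T *L recip (A T U)))
        ≡⟨ ∑-ext (allSubsets m) (λ T → coeff-·L k (σ T U) (A S T *L recip (A T U))) ⟩
      ∑[ T ← allSubsets m ] σ T U * coeff k (A S T *L recip (A T U))
        ≡⟨ ∑-signed-A*recipA (λ T → σ T U) S U (alternating-intervalˡ U S) k ⟩
      χ (S ≟S U) * χ (+ 0 ≟ℤ k)
        ≡⟨ sym (coeff-Id S U k) ⟩
      coeff k (Id S U) ∎
      where
      open ≡-Reasoning
      σ : Subset m → Subset m → ℤ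
      σ T U = sign (∣ T ∣ ℕ.+ ∣ U ∣)
    left : (signedRecip A ⊗ A) ≈M Id
    left S U k = begin
      coeff k ((signedRecip A ⊗ A) S U)
        ≡⟨ coeff-⊗ (signedRecip A) A S U k ⟩
      ∑[ T ← allSubsets m ] coeff k ((σ S T ·L recip (A S T)) *L A T U)
        ≡⟨ ∑-ext (allSubsets m) (λ T → ·L-*L (σ S T) (recip (A S T)) (A T U) k) ⟩
      ∑[ T ← allSubsets m ] coeff k (σ S T ·L (recip (A S T) *L A T U))
        ≡⟨ ∑-ext (allSubsets m) (λ T → coeff-·L k (σ S T) (recip (A S T) *L A T U)) ⟩
      ∑[ T ← allSubsets m ] σ S T * coeff k (recip (A S T) *L A T U)
        ≡⟨ ∑-ext (allSubsets m) (λ T → cong (σ S T *_) (coeff-recip-*L k (A S T) (A T U))) ⟩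
      ∑[ T ← allSubsets m ] σ S T * coeff (- k) (A S T *L recip (A T U))
        ≡⟨ ∑-signed-A*recipA (σ S) S U (alternating-intervalʳ U S) (- k) ⟩
      χ (S ≟S U) * χ (+ 0 ≟ℤ - k)
        ≡⟨ cong (χ (S ≟S U) *_) (χ-0≟-k k) ⟩
      χ (S ≟S U) * χ (+ 0 ≟ℤ k)
        ≡⟨ sym (coeff-Id S U k) ⟩
      coeff k (Id S U) ∎
      where
      open ≡-Reasoning
      σ : Subset m → Subset m → ℤ
      σ S T = sign (∣ S ∣ ℕ.+ ∣ T ∣)

-- B, B′ and Γ

∁-involutive : ∀ {m} (S : Subset m) → ∁ (∁ S) ≡ S
∁-involutive []          = refl
∁-involutive (true ∷ S)  = cong (true ∷_) (∁-involutive S)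
∁-involutive (false ∷ S) = cong (false ∷_) (∁-involutive S)

module _ {m : ℕ} where

  invSum-⊗-scalar : ∀ {P Q : Subset m → Subset m → Perm m → Set}
                    (P? : ∀ S T w → Dec (P S T w)) (Q? : ∀ S T w → Dec (Q S T w)) (c : Subset m → Subset m → ℤ) →
                    (∀ S T w → χ (Q? S T w) ≡ ∑[ U ← allSubsets m ] χ (P? S U w) * c U T) →
                    (λ S T → invSum (Q? S T)) ≋ ((λ S T → invSum (P? S T)) ⊗ scalar c)
  invSum-⊗-scalar P? Q? c Q≡∑P*c = mk≋ λ S T k → begin
    coeff k (invSum (Q? S T))
      ≡⟨ coeff-invSum (Q? S T) k ⟩
    ∑[ w ← Sym (suc m) ] χ (Q? S T w) * δ-inv k w
      ≡⟨ ∑-ext (Sym (suc m)) (λ w → cong (_* δ-inv k w) (Q≡∑P*c S T w)) ⟩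
    ∑[ w ← Sym (suc m) ] (∑[ U ← allSubsets m ] χ (P? S U w) * c U T) * δ-inv k w
      ≡⟨ ∑-ext (Sym (suc m)) (λ w → sym (∑-*ʳ (allSubsets m) (δ-inv k w) _)) ⟩
    ∑[ w ← Sym (suc m) ] ∑[ U ← allSubsets m ] χ (P? S U w) * c U T * δ-inv k w
      ≡⟨ ∑-comm (Sym (suc m)) (allSubsets m) _ ⟩
    ∑[ U ← allSubsets m ] ∑[ w ← Sym (suc m) ] χ (P? S U w) * c U T * δ-inv k w
      ≡⟨ ∑-ext (allSubsets m) (λ U → ∑-ext (Sym (suc m)) (λ w → xy∙z≈xz∙y (χ (P? S U w)) (c U T) (δ-inv k w))) ⟩
    ∑[ U ← allSubsets m ] ∑[ w ← Sym (suc m) ] χ (P? S U w) * δ-inv k w * c U T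
      ≡⟨ ∑-ext (allSubsets m) (λ U → ∑-*ʳ (Sym (suc m)) (c U T) _) ⟩
    ∑[ U ← allSubsets m ] (∑[ w ← Sym (suc m) ] χ (P? S U w) * δ-inv k w) * c U T
      ≡⟨ ∑-ext (allSubsets m) (λ U → cong (_* c U T) (sym (coeff-invSum (P? S U) k))) ⟩
    ∑[ U ← allSubsets m ] coeff k (invSum (P? S U)) * c U T
      ≡⟨ sym (⊗-scalarʳ (λ S T → invSum (P? S T)) c S T k) ⟩
    coeff k (((λ S T → invSum (P? S T)) ⊗ scalar c) S T) ∎
    where
    open ≡-Reasoning
    δ-inv : ℤ → Perm m → ℤ
    δ-inv k w = χ (+ inv w ≟ℤ k)

  scalar-⊗-invSum : ∀ {P Q : Subset m → Subset m → Perm m → Set}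
                    (P? : ∀ S T w → Dec (P S T w)) (Q? : ∀ S T w → Dec (Q S T w)) (c : Subset m → Subset m → ℤ) →
                    (∀ S T w → χ (Q? S T w) ≡ ∑[ U ← allSubsets m ] c S U * χ (P? U T w)) →
                    (λ S T → invSum (Q? S T)) ≋ (scalar c ⊗ (λ S T → invSum (P? S T)))
  scalar-⊗-invSum P? Q? c Q≡∑c*P = mk≋ λ S T k → begin
    coeff k (invSum (Q? S T))
      ≡⟨ coeff-invSum (Q? S T) k ⟩
    ∑[ w ← Sym (suc m) ] χ (Q? S T w) * δ-inv k w
      ≡⟨ ∑-ext (Sym (suc m)) (λ w → cong (_* δ-inv k w) (Q≡∑c*P S T w)) ⟩
    ∑[ w ← Sym (suc m) ] (∑[ U ← allSubsets m ] c S U * χ (P? U T w)) * δ-inv k w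
      ≡⟨ ∑-ext (Sym (suc m)) (λ w → sym (∑-*ʳ (allSubsets m) (δ-inv k w) _)) ⟩
    ∑[ w ← Sym (suc m) ] ∑[ U ← allSubsets m ] c S U * χ (P? U T w) * δ-inv k w
      ≡⟨ ∑-comm (Sym (suc m)) (allSubsets m) _ ⟩
    ∑[ U ← allSubsets m ] ∑[ w ← Sym (suc m) ] c S U * χ (P? U T w) * δ-inv k w
      ≡⟨ ∑-ext (allSubsets m) (λ U → ∑-ext (Sym (suc m)) (λ w → *-assoc (c S U) (χ (P? U T w)) (δ-inv k w))) ⟩
    ∑[ U ← allSubsets m ] ∑[ w ← Sym (suc m) ] c S U * (χ (P? U T w) * δ-inv k w)
      ≡⟨ ∑-ext (allSubsets m) (λ U → ∑-*ˡ (Sym (suc m)) (c S U) _) ⟩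
    ∑[ U ← allSubsets m ] c S U * (∑[ w ← Sym (suc m) ] χ (P? U T w) * δ-inv k w)
      ≡⟨ ∑-ext (allSubsets m) (λ U → cong (c S U *_) (sym (coeff-invSum (P? U T) k))) ⟩
    ∑[ U ← allSubsets m ] c S U * coeff k (invSum (P? U T))
      ≡⟨ sym (⊗-scalarˡ (λ S T → invSum (P? S T)) c S T k) ⟩
    coeff k ((scalar c ⊗ (λ S T → invSum (P? S T))) S T) ∎
    where
    open ≡-Reasoning
    δ-inv : ℤ → Perm m → ℤ
    δ-inv k w = χ (+ inv w ≟ℤ k)

  χ-∁⊆ : ∀ (U Y : Subset m) → χ (∁ U ⊆? Y) ≡ χ (∁ Y ⊆? U)
  χ-∁⊆ U Y = χ-⇔ (∁ U ⊆? Y) (∁ Y ⊆? U) (mk⇔ (flip U Y) (flip Y U))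
    where
    flip : ∀ U Y → ∁ U ⊆ Y → ∁ Y ⊆ U
    flip U Y ∁U⊆Y = subst (∁ Y ⊆_) (∁-involutive U) (p⊆q⇒∁p⊇∁q ∁U⊆Y)

  χ-∁≟ : ∀ (S Y : Subset m) → χ (∁ Y ≟S S) ≡ χ (∁ S ≟S Y)
  χ-∁≟ S Y = χ-⇔ (∁ Y ≟S S) (∁ S ≟S Y) (mk⇔ (flip Y S) (flip S Y))
    where
    flip : ∀ Y S → ∁ Y ≡ S → ∁ S ≡ Y
    flip Y S ∁Y≡S = trans (cong ∁ (sym ∁Y≡S)) (∁-involutive Y)

  möbius-descents : ∀ (T : Subset m) (w : Perm m) → ∑[ U ← allSubsets m ] χ (U ⊆? D w) * μ-entry U T ≡ χ (T ≟S D w)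
  möbius-descents T w = trans (∑-ext (allSubsets m) (λ U → x∙yz≈y∙zx (χ (U ⊆? D w)) (sign (∣ U ∣ ℕ.+ ∣ T ∣)) (χ (T ⊆? U))))
                              (alternating-intervalˡ T (D w))

  möbius-cuts : ∀ (S : Subset m) (w : Perm m) → ∑[ U ← allSubsets m ] μ-entry S U * χ (∁ U ⊆? C w) ≡ χ (∁ S ≟S C w)
  möbius-cuts S w = begin
    ∑[ U ← allSubsets m ] sign (∣ S ∣ ℕ.+ ∣ U ∣) * χ (U ⊆? S) * χ (∁ U ⊆? C w)
      ≡⟨ ∑-ext (allSubsets m) (λ U → trans (cong (sign (∣ S ∣ ℕ.+ ∣ U ∣) * χ (U ⊆? S) *_) (χ-∁⊆ U (C w)))
                                           (xy∙z≈x∙zy (sign (∣ S ∣ ℕ.+ ∣ U ∣)) (χ (U ⊆? S)) (χ (∁ (C w) ⊆? U)))) ⟩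
    ∑[ U ← allSubsets m ] sign (∣ S ∣ ℕ.+ ∣ U ∣) * (χ (∁ (C w) ⊆? U) * χ (U ⊆? S))
      ≡⟨ alternating-intervalʳ (∁ (C w)) S ⟩
    χ (∁ (C w) ≟S S)
      ≡⟨ χ-∁≟ S (C w) ⟩
    χ (∁ S ≟S C w) ∎
    where
    open ≡-Reasoning

  B? : ∀ S T (w : Perm m) → Dec (∁ S ⊆ C w × T ≡ D w)
  B? S T w = (∁ S ⊆? C w) ×-dec (T ≟S D w)

  B′? : ∀ S T (w : Perm m) → Dec (∁ S ≡ C w × T ⊆ D w)
  B′? S T w = (∁ S ≟S C w) ×-dec (T ⊆? D w)

  Γ? : ∀ S T (w : Perm m) → Dec (C w ≡ ∁ S × D w ≡ T)
  Γ? S T w = (C w ≟S ∁ S) ×-dec (D w ≟S T)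

  B≋A⊗μ : B ≋ A ⊗ μ
  B≋A⊗μ = invSum-⊗-scalar A? B? μ-entry pointwise
    where
    pointwise : ∀ S T w → χ (B? S T w) ≡ ∑[ U ← allSubsets m ] χ (A? S U w) * μ-entry U T
    pointwise S T w = begin
      χ ((∁ S ⊆? C w) ×-dec (T ≟S D w))
        ≡⟨ χ-× (∁ S ⊆? C w) (T ≟S D w) ⟩
      χ (∁ S ⊆? C w) * χ (T ≟S D w)
        ≡⟨ cong (χ (∁ S ⊆? C w) *_) (sym (möbius-descents T w)) ⟩
      χ (∁ S ⊆? C w) * (∑[ U ← allSubsets m ] χ (U ⊆? D w) * μ-entry U T)
        ≡⟨ sym (∑-*ˡ (allSubsets m) (χ (∁ S ⊆? C w)) (λ U → χ (U ⊆? D w) * μ-entry U T)) ⟩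
      ∑[ U ← allSubsets m ] χ (∁ S ⊆? C w) * (χ (U ⊆? D w) * μ-entry U T)
        ≡⟨ ∑-ext (allSubsets m) (λ U → sym (*-assoc (χ (∁ S ⊆? C w)) (χ (U ⊆? D w)) (μ-entry U T))) ⟩
      ∑[ U ← allSubsets m ] χ (∁ S ⊆? C w) * χ (U ⊆? D w) * μ-entry U T
        ≡⟨ ∑-ext (allSubsets m) (λ U → cong (_* μ-entry U T) (sym (χ-× (∁ S ⊆? C w) (U ⊆? D w)))) ⟩
      ∑[ U ← allSubsets m ] χ (A? S U w) * μ-entry U T ∎
      where open ≡-Reasoning

  module _ {R : Subset m → Perm m → Set} (R? : ∀ T w → Dec (R T w)) where

    cut-möbius : ∀ S T w → χ (∁ S ≟S C w) * χ (R? T w) ≡ ∑[ U ← allSubsets m ] μ-entry S U * χ ((∁ U ⊆? C w) ×-dec R? T w)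
    cut-möbius S T w = begin
      χ (∁ S ≟S C w) * χ (R? T w)
        ≡⟨ cong (_* χ (R? T w)) (sym (möbius-cuts S w)) ⟩
      (∑[ U ← allSubsets m ] μ-entry S U * χ (∁ U ⊆? C w)) * χ (R? T w)
        ≡⟨ sym (∑-*ʳ (allSubsets m) (χ (R? T w)) (λ U → μ-entry S U * χ (∁ U ⊆? C w))) ⟩
      ∑[ U ← allSubsets m ] μ-entry S U * χ (∁ U ⊆? C w) * χ (R? T w)
        ≡⟨ ∑-ext (allSubsets m) (λ U → *-assoc (μ-entry S U) (χ (∁ U ⊆? C w)) (χ (R? T w))) ⟩
      ∑[ U ← allSubsets m ] μ-entry S U * (χ (∁ U ⊆? C w) * χ (R? T w))
        ≡⟨ ∑-ext (allSubsets m) (λ U → cong (μ-entry S U *_) (sym (χ-× (∁ U ⊆? C w) (R? T w)))) ⟩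
      ∑[ U ← allSubsets m ] μ-entry S U * χ ((∁ U ⊆? C w) ×-dec R? T w) ∎
      where open ≡-Reasoning

  B′≋μ⊗A : B' ≋ μ ⊗ A
  B′≋μ⊗A = scalar-⊗-invSum A? B′? μ-entry
    (λ S T w → trans (χ-× (∁ S ≟S C w) (T ⊆? D w)) (cut-möbius (λ T w → T ⊆? D w) S T w))

  Γ≋μ⊗B : Γ ≋ μ ⊗ B
  Γ≋μ⊗B = scalar-⊗-invSum B? Γ? μ-entry λ S T w → begin
    χ (Γ? S T w)                           ≡⟨ χ-× (C w ≟S ∁ S) (D w ≟S T) ⟩
    χ (C w ≟S ∁ S) * χ (D w ≟S T)          ≡⟨ cong₂ _*_ (χ-≡-sym (C w ≟S ∁ S) (∁ S ≟S C w)) (χ-≡-sym (D w ≟S T) (T ≟S D w)) ⟩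
    χ (∁ S ≟S C w) * χ (T ≟S D w)          ≡⟨ cut-möbius (λ T w → T ≟S D w) S T w ⟩
    ∑[ U ← allSubsets m ] μ-entry S U * χ (B? U T w) ∎
    where open ≡-Reasoning

  μ-ζ-inverse : IsInverse (μ {m}) ζ
  μ-ζ-inverse = proj₂ ζ-μ-inverse , proj₁ ζ-μ-inverse

  A⊗μ-inverse : IsInverse (A ⊗ μ) (ζ ⊗ signedRecip A)
  A⊗μ-inverse = IsInverse-⊗ {M = A} {signedRecip A} {μ} {ζ} A-inverse μ-ζ-inverse

  μ⊗A⊗μ-inverse : IsInverse (μ ⊗ (A ⊗ μ)) ((ζ ⊗ signedRecip A) ⊗ ζ)
  μ⊗A⊗μ-inverse = IsInverse-⊗ {M = μ} {ζ} {A ⊗ μ} {ζ ⊗ signedRecip A} μ-ζ-inverse A⊗μ-inverse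

  signedRecip-B′ : signedRecip B' ≋ ζ ⊗ signedRecip A
  signedRecip-B′ = begin
    signedRecip B'                   ≈⟨ signedRecip-cong B′≋μ⊗A ⟩
    signedRecip (μ ⊗ A)              ≈⟨ signedRecip-⊗ μ A ⟩
    signedRecip μ ⊗ signedRecip A    ≈⟨ ⊗-congˡ (signedRecip A) signedRecip-μ ⟩
    ζ ⊗ signedRecip A                ∎
    where open import Relation.Binary.Reasoning.Setoid ≋-setoid

  signedRecip-Γ : signedRecip Γ ≋ (ζ ⊗ signedRecip A) ⊗ ζ
  signedRecip-Γ = begin
    signedRecip Γ                                ≈⟨ signedRecip-cong Γ≋μ⊗B ⟩
    signedRecip (μ ⊗ B)                          ≈⟨ signedRecip-⊗ μ B ⟩
    signedRecip μ ⊗ signedRecip B                ≈⟨ ⊗-cong signedRecip-μ (signedRecip-cong B≋A⊗μ) ⟩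
    ζ ⊗ signedRecip (A ⊗ μ)                      ≈⟨ ⊗-congʳ ζ (signedRecip-⊗ A μ) ⟩
    ζ ⊗ (signedRecip A ⊗ signedRecip μ)          ≈⟨ ⊗-congʳ ζ (⊗-congʳ (signedRecip A) signedRecip-μ) ⟩
    ζ ⊗ (signedRecip A ⊗ ζ)                      ≈⟨ ≋-sym (⊗-assoc ζ (signedRecip A) ζ) ⟩
    (ζ ⊗ signedRecip A) ⊗ ζ                      ∎
    where open import Relation.Binary.Reasoning.Setoid ≋-setoid

theorem2p3 : (m : ℕ)
    → IsInverse (A {m}) (signedRecip A)
      × IsInverse (B {m}) (signedRecip B')
      × IsInverse (Γ {m}) (signedRecip Γ)
theorem2p3 m = A-inverse , B-inverse , Γ-inverse
  where
  B-inverse : IsInverse (B {m}) (signedRecip B')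
  B-inverse = IsInverse-cong (≋-sym B≋A⊗μ) (≋-sym signedRecip-B′) A⊗μ-inverse
  Γ-inverse : IsInverse (Γ {m}) (signedRecip Γ)
  Γ-inverse = IsInverse-cong (≋-sym (≋-trans Γ≋μ⊗B (⊗-congʳ μ B≋A⊗μ))) (≋-sym signedRecip-Γ) μ⊗A⊗μ-inverse
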